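{- Let $w$ be a string of length $n$ and run algorithm findmaxr on $(w, ml)$ with $ml=1$. Then every reported string is a maximal repeat of $w$, the reported positions $r[p_i],\dots,r[n_i]$ are exactly all of its occurrences in $w$, every maximal repeat of $w$ is reported, and the maximal repeats are reported in non-decreasing order of length.
   Context: Positions of $w$ are numbered $1,\dots,n$; $w[i..j]$ denotes the substring from position $i$ to $j$ inclusive (substrings are nonempty). A string $u$ occurs in $w$ at position $i$ if $u=w[i..i+|u|-1]$. An extension of $u$ is any string having $u$ as a proper substring. A maximal repeat of $w$ is a string that occurs more than once in $w$ and each of whose extensions occurs fewer times in $w$. The suffix array $r$ of $w$ is the permutation of $\{1,\dots,n\}$ with $w[r[i]..n]$ lexicographically smaller than $w[r[j]..n]$ whenever $i<j$; $p$ is its inverse ($p[r[i]]=i$); for $1\le i<n$, $LCP[i]$ is the length of the longest common prefix of $w[r[i]..n]$ and $w[r[i+1]..n]$. Algorithm findmaxr$(w,ml)$: compute $r$, $p$, $LCP$. Let $S:=\{t\in\{1,\dots,n-1\}: LCP[t]<ml\}\cup\{0,n\}$. Process the indices $t\in\{1,\dots,n-1\}$ with $LCP[t]\ge ml$ one at a time in non-decreasing order of $LCP[t]$. For the current index $i$: set $p_i:=\max\{j\in S: j<i\}+1$ and $n_i:=\min\{j\in S: j>i\}$, then insert $i$ into $S$. If ($p_i=1$ or $LCP[p_i-1]\neq LCP[i]$) and ($n_i=n$ or $LCP[n_i]\neq LCP[i]$), and moreover ($r[p_i]=1$ or $r[n_i]=1$ or $w[r[p_i]-1]\neq w[r[n_i]-1]$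 or $p[r[n_i]-1]-p[r[p_i]-1]\neq n_i-p_i$), then report the string $w[r[i]..r[i]+LCP[i]-1]$ together with its $n_i-p_i+1$ positions $r[p_i],r[p_i+1],\dots,r[n_i]$. -}

module Defs where

open import Data.Nat using (ℕ; zero; suc; _+_; _∸_; _≤_; _<_; _⊔_; _⊓_; _<ᵇ_; _≡ᵇ_; _≤?_; _<?_)
open import Data.Bool using (Bool; true; false; if_then_else_; _∨_; not)
open import Data.List using (List; []; _∷_; _++_; length; take; drop; map; upTo; filter)
open import Data.Maybe using (Maybe; just; nothing)
import Data.Maybe.Properties as MaybeP
open import Data.Product using (_×_; _,_; ∃)
open import Relation.Binary.PropositionalEquality using (_≡_; _≢_)
open import Relation.Binary.Definitions using (DecidableEquality)
open import Relation.Binary.Structures using (IsStrictTotalOrder)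
open import Relation.Binary.Core using (Rel)
open import Relation.Nullary using (does; Dec; yes; no)
open import Data.List.Relation.Binary.Lex.Strict using (Lex-<)

range : ℕ → ℕ → List ℕ
range a b = map (a +_) (upTo (suc b ∸ a))

module Strings {A : Set} (_≟_ : DecidableEquality A) where

  -- Positions are 1-based.  w[k..n] :
  suffix : List A → ℕ → List A
  suffix w k = drop (k ∸ 1) w

  sub : List A → ℕ → ℕ → List A
  sub w i j = take (suc j ∸ i) (suffix w i)

  charAt : List A → ℕ → Maybe A
  charAt w zero = nothing
  charAt [] (suc k) = nothing
  charAt (x ∷ w) (suc zero) = just x
  charAt (x ∷ w) (suc (suc k)) = charAt w (suc k)

  OccursAt : List A → List A → ℕ → Set
  OccursAt w u i = (1 ≤ i) × (1 ≤ length u) × (i + length u ∸ 1 ≤ length w)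
                   × (u ≡ sub w i (i + length u ∸ 1))

  occursAt? : (w u : List A) (i : ℕ) → Dec (OccursAt w u i)
  occursAt? w u i with 1 ≤? i | 1 ≤? length u | i + length u ∸ 1 ≤? length w
                       | Data.List.Properties.≡-dec _≟_ u (sub w i (i + length u ∸ 1))
    where import Data.List.Properties
  ... | yes a | yes b | yes c | yes d = yes (a , b , c , d)
  ... | no ¬a | _ | _ | _ = no λ { (a , _) → ¬a a }
  ... | yes _ | no ¬b | _ | _ = no λ { (_ , b , _) → ¬b b }
  ... | yes _ | yes _ | no ¬c | _ = no λ { (_ , _ , c , _) → ¬c c }
  ... | yes _ | yes _ | yes _ | no ¬d = no λ { (_ , _ , _ , d) → ¬d d }

  occ : List A → List A → ℕ
  occ w u = length (filter (occursAt? w u) (range 1 (length w)))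

  IsExtension : List A → List A → Set
  IsExtension u v = ∃ (λ i → OccursAt v u i) × (u ≢ v)

  MaximalRepeat : List A → List A → Set
  MaximalRepeat w u = (2 ≤ occ w u) × (∀ v → IsExtension u v → occ w v < occ w u)

  lcp : List A → List A → ℕ
  lcp (x ∷ xs) (y ∷ ys) with x ≟ y
  ... | yes _ = suc (lcp xs ys)
  ... | no _  = 0
  lcp _ _ = 0

  IsSuffixArray : (_≺_ : Rel A _) → List A → (ℕ → ℕ) → Set
  IsSuffixArray _≺_ w r =
    (∀ i → 1 ≤ i → i ≤ length w → (1 ≤ r i) × (r i ≤ length w)) ×
    (∀ i j → 1 ≤ i → i < j → j ≤ length w →
       Lex-< _≡_ _≺_ (suffix w (r i)) (suffix w (r j)))

  IsInverse : List A → (ℕ → ℕ) → (ℕ → ℕ) → Set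
  IsInverse w r p = ∀ i → 1 ≤ i → i ≤ length w → p (r i) ≡ i

  LCP : List A → (ℕ → ℕ) → ℕ → ℕ
  LCP w r t = lcp (suffix w (r t)) (suffix w (r (suc t)))

  -- max{ j ∈ S : j < i }  (S always contains 0)
  maxBelow : ℕ → List ℕ → ℕ
  maxBelow i [] = 0
  maxBelow i (j ∷ S) = if j <ᵇ i then j ⊔ maxBelow i S else maxBelow i S

  -- min{ j ∈ S : j > i }  (S always contains n, used as default d)
  minAbove : ℕ → ℕ → List ℕ → ℕ
  minAbove d i [] = d
  minAbove d i (j ∷ S) = if i <ᵇ j then j ⊓ minAbove d i S else minAbove d i S

  eqChar : Maybe A → Maybe A → Bool
  eqChar a b = does (MaybeP.≡-dec _≟_ a b)

  Report : Set
  Report = List A × List ℕ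

  -- Algorithm findmaxr, with the suffix array r, its inverse p and the
  -- processing order of the indices given explicitly.
  module FindMaxR (w : List A) (r p : ℕ → ℕ) where
    n : ℕ
    n = length w

    L : ℕ → ℕ
    L = LCP w r

    initialS : ℕ → List ℕ
    initialS ml = filter (λ t → L t <? ml) (range 1 (n ∸ 1)) ++ (0 ∷ n ∷ [])

    toProcess : ℕ → List ℕ
    toProcess ml = filter (λ t → ml ≤? L t) (range 1 (n ∸ 1))

    reportCond : ℕ → ℕ → ℕ → Bool
    reportCond i pi ni =
      ((pi ≡ᵇ 1) ∨ not (L (pi ∸ 1) ≡ᵇ L i)) Data.Bool.∧
      ((ni ≡ᵇ n) ∨ not (L ni ≡ᵇ L i)) Data.Bool.∧
      ((r pi ≡ᵇ 1) ∨ (r ni ≡ᵇ 1)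
        ∨ not (eqChar (charAt w (r pi ∸ 1)) (charAt w (r ni ∸ 1)))
        -- p[r[ni]-1] - p[r[pi]-1] ≠ ni - pi   (over ℤ; here ni ≥ pi)
        ∨ not (p (r ni ∸ 1) ≡ᵇ p (r pi ∸ 1) + (ni ∸ pi)))

    run : List ℕ → List ℕ → List Report
    run S [] = []
    run S (i ∷ is) =
      let pi = maxBelow i S + 1
          ni = minAbove n i S
      in (if reportCond i pi ni
            then (sub w (r i) (r i + L i ∸ 1) , map r (range pi ni)) ∷ []
            else [])
         ++ run (i ∷ S) is

    findmaxr : ℕ → List ℕ → List Report
    findmaxr ml order = run (initialS ml) order

module Submission where

open import Defs
open import Data.Bool using (Bool; true; false; T; not; _∨_; _∧_; if_then_else_)
open import Data.Bool.Properties using (T-∨; T-∧)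
open import Data.Empty using (⊥; ⊥-elim)
open import Data.List using (List; []; _∷_; _++_; _ʳ++_; length; take; drop; map; upTo; filter; head)
import Data.List.Properties as List
open import Data.List.Membership.Propositional using (_∈_; _∉_; find)
open import Data.List.Membership.Propositional.Properties
open import Data.List.Relation.Binary.Lex.Strict using (Lex-<; this; next) renaming (<-isStrictPartialOrder to Lex-isStrictPartialOrder)
open import Data.List.Relation.Binary.Permutation.Propositional using (_↭_; ↭-sym)
open import Data.List.Relation.Binary.Permutation.Propositional.Properties using (∈-resp-↭)
open import Data.List.Relation.Binary.Pointwise using (≡⇒Pointwise-≡)
open import Data.List.Relation.Unary.All as All using (All; []; _∷_)
import Data.List.Relation.Unary.All.Properties as All
open import Data.List.Relation.Unary.AllPairs using (AllPairs; []; _∷_)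
open import Data.List.Relation.Unary.Any using (here; there; any?)
import Data.List.Relation.Unary.Any.Properties as Any
open import Data.List.Relation.Unary.Linked using (Linked)
open import Data.List.Relation.Unary.Linked.Properties using (Linked⇒AllPairs; AllPairs⇒Linked)
open import Data.List.Relation.Unary.Unique.Propositional using (Unique)
import Data.List.Relation.Unary.Unique.Propositional.Properties as Unique
open import Data.Maybe using (just)
import Data.Maybe.Properties as Maybe
open import Data.Nat using (ℕ; zero; suc; _+_; _∸_; _≤_; _<_; z≤n; s≤s; _≤?_; _<?_; _≡ᵇ_; _<ᵇ_; pred)
open import Data.Nat.Properties
open import Data.List.Membership.DecPropositional _≟_ using (_∈?_)
open import Data.Product using (_×_; _,_; proj₁; proj₂; ∃)
import Data.Product as Product
open import Data.Product.Function.NonDependent.Propositional using (_×-⇔_)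
open import Data.Sum using (_⊎_; inj₁; inj₂; [_,_]′)
import Data.Sum as Sum
open import Data.Sum.Function.Propositional using (_⊎-⇔_)
open import Function.Bundles using (Equivalence; _⇔_; mk⇔)
open import Function.Properties.Equivalence using () renaming (trans to Equivalence-trans)
open import Level using (0ℓ)
open import Relation.Binary.Core using (Rel)
open import Relation.Binary.Definitions using (tri<; tri≈; tri>)
open import Relation.Binary.PropositionalEquality
open import Relation.Binary.Structures using (IsStrictTotalOrder; IsStrictPartialOrder)
open import Relation.Nullary using (¬_; Dec; yes; no)
open import Relation.Nullary.Decidable using (_×-dec_; decidable-stable)

-- The ranks j whose suffix s j = w[r[j]..n] starts with a string u form an interval [a, b] of
-- the suffix array: an lcp-interval, in which every LCP[t] (a ≤ t < b) is at least |u| while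
-- LCP[a-1] and LCP[b] are smaller.  When findmaxr processes i, S holds the indices of smaller
-- LCP and the processed ones, so the neighbours of i in S bound a block of LCP values ≥ LCP[i]
-- around i; the first two report conditions say that the LCP values just outside the block are
-- strictly smaller, so it is an lcp-interval.  Its string is right-maximal (s i and s (i+1) differ
-- after LCP[i] letters) with occurrences r[p_i..n_i].  Left-maximality is the third condition:
-- if every occurrence were preceded by one letter c, the map j ↦ p[r[j]-1] would send [a, b]
-- increasingly onto the interval of c u, i.e. shift it rigidly.  Conversely, the interval of a
-- maximal repeat u contains an LCP equal to |u| (otherwise u is not right-maximal), and the
-- first such index to be processed reports u.  Reports come in the order of LCP[i] = |u|.

module _ {X : Set} where

  Unique⊆⇒length≤ : {xs ys : List X} → Unique xs → (∀ {x} → x ∈ xs → x ∈ ys) → length xs ≤ length ys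
  Unique⊆⇒length≤ {[]} _ _ = z≤n
  Unique⊆⇒length≤ {x ∷ xs} {ys} (x∉xs ∷ uxs) xs⊆ys with ∈-∃++ (xs⊆ys (here refl))
  ... | ys₁ , ys₂ , refl = begin
      suc (length xs)            ≤⟨ s≤s (Unique⊆⇒length≤ uxs xs⊆ys₁++ys₂) ⟩
      suc (length (ys₁ ++ ys₂))  ≡⟨ cong suc (List.length-++ ys₁) ⟩
      suc (length ys₁ + length ys₂) ≡⟨ +-suc (length ys₁) (length ys₂) ⟨
      length ys₁ + length (x ∷ ys₂) ≡⟨ List.length-++ ys₁ ⟨
      length (ys₁ ++ x ∷ ys₂)    ∎
    where
    open ≤-Reasoning
    xs⊆ys₁++ys₂ : ∀ {z} → z ∈ xs → z ∈ ys₁ ++ ys₂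
    xs⊆ys₁++ys₂ z∈xs with ∈-++⁻ ys₁ (xs⊆ys (there z∈xs))
    ... | inj₁ z∈ys₁ = ∈-++⁺ˡ z∈ys₁
    ... | inj₂ (here refl) = ⊥-elim (All.lookup x∉xs z∈xs refl)
    ... | inj₂ (there z∈ys₂) = ∈-++⁺ʳ ys₁ z∈ys₂

  map-unique-on : ∀ {Y : Set} (f : X → Y) xs → Unique xs
    → (∀ {x y} → x ∈ xs → y ∈ xs → f x ≡ f y → x ≡ y) → Unique (map f xs)
  map-unique-on f [] _ _ = []
  map-unique-on f (x ∷ xs) (x∉xs ∷ uxs) inj =
    All.map⁺ (All.tabulate (λ y∈xs fx≡fy → All.lookup x∉xs y∈xs (inj (here refl) (there y∈xs) fx≡fy)))
    ∷ map-unique-on f xs uxs (λ x∈ y∈ → inj (there x∈) (there y∈))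

  first-satisfying : ∀ {Q : X → Set} → (∀ x → Dec (Q x)) → ∀ xs {x₀} → x₀ ∈ xs → Q x₀ →
    ∃ λ pre → ∃ λ x → ∃ λ post → xs ≡ pre ++ x ∷ post × Q x × (∀ {y} → y ∈ pre → ¬ Q y)
  first-satisfying Q? (x ∷ xs) (here refl) q = [] , x , xs , refl , q , λ ()
  first-satisfying Q? (x ∷ xs) (there x₀∈xs) q with Q? x
  ... | yes qx = [] , x , xs , refl , qx , λ ()
  ... | no ¬qx with first-satisfying Q? xs x₀∈xs q
  ...   | pre , y , post , refl , qy , none =
    x ∷ pre , y , post , refl , qy , λ { (here refl) → ¬qx ; (there z∈) → none z∈ }

  Unique⇒two-distinct : ∀ {xs : List X} → 2 ≤ length xs → Unique xs → ∃ λ x → ∃ λ y → x ∈ xs × y ∈ xs × x ≢ y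
  Unique⇒two-distinct {x ∷ y ∷ _} (s≤s (s≤s z≤n)) ((x≢y ∷ _) ∷ _) = x , y , here refl , there (here refl) , x≢y

  AllPairs-before : ∀ {R : Rel X 0ℓ} pre x post → AllPairs R (pre ++ x ∷ post) → ∀ {y} → y ∈ pre → R y x
  AllPairs-before (y ∷ pre) x post (ry ∷ _) (here refl) = All.lookup ry (∈-++⁺ʳ pre (here refl))
  AllPairs-before (_ ∷ pre) x post (_ ∷ rs) (there y∈pre) = AllPairs-before pre x post rs y∈pre

  AllPairs-after : ∀ {R : Rel X 0ℓ} pre x post → AllPairs R (pre ++ x ∷ post) → ∀ {y} → y ∈ post → R x y
  AllPairs-after [] x post (rx ∷ _) y∈post = All.lookup rx y∈post
  AllPairs-after (_ ∷ pre) x post (_ ∷ rs) y∈post = AllPairs-after pre x post rs y∈post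

∈-range⁻ : ∀ {a b k} → k ∈ range a b → a ≤ k × k ≤ b
∈-range⁻ {a} {b} k∈ with ∈-map⁻ (a +_) k∈
... | x , x∈ , refl = m≤m+n a x , a+x≤b
  where
  a+x≤b : a + x ≤ b
  a+x≤b with a ≤? suc b
  ... | yes a≤1+b = ≤-pred (≤-trans (+-monoʳ-< a (∈-upTo⁻ x∈)) (≤-reflexive (m+[n∸m]≡n a≤1+b)))
  ... | no a≰1+b = ⊥-elim (n≮0 (subst (x <_) (m≤n⇒m∸n≡0 (≤-trans (n≤1+n (suc b)) (≰⇒> a≰1+b))) (∈-upTo⁻ x∈)))

∈-range⁺ : ∀ {a b k} → a ≤ k → k ≤ b → k ∈ range a b
∈-range⁺ {a} {b} a≤k k≤b =
  subst (_∈ range a b) (m+[n∸m]≡n a≤k) (∈-map⁺ (a +_) (∈-upTo⁺ (∸-monoˡ-< (s≤s k≤b) a≤k)))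

range-unique : ∀ a b → Unique (range a b)
range-unique a b = Unique.map⁺ (+-cancelˡ-≡ a _ _)
  (Unique.applyUpTo⁺₁ (λ x → x) (suc b ∸ a) (λ i<j _ → <⇒≢ i<j))

length-range : ∀ a b → length (range a b) ≡ suc b ∸ a
length-range a b = trans (List.length-map (a +_) (upTo (suc b ∸ a))) (List.length-upTo (suc b ∸ a))

strictlyIncreasing⇒+≤ : ∀ (f : ℕ → ℕ) x y → (∀ a b → x ≤ a → a < b → b ≤ y → f a < f b)
  → ∀ d → x + d ≤ y → f x + d ≤ f (x + d)
strictlyIncreasing⇒+≤ f x y mono zero _ = ≤-reflexive (trans (+-identityʳ (f x)) (cong f (sym (+-identityʳ x))))
strictlyIncreasing⇒+≤ f x y mono (suc d) x+1+d≤y = begin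
  f x + suc d       ≡⟨ +-suc (f x) d ⟩
  suc (f x + d)     ≤⟨ s≤s (strictlyIncreasing⇒+≤ f x y mono d (≤-trans (+-monoʳ-≤ x (n≤1+n d)) x+1+d≤y)) ⟩
  suc (f (x + d))   ≤⟨ mono (x + d) (x + suc d) (m≤m+n x d) (≤-reflexive (sym (+-suc x d))) x+1+d≤y ⟩
  f (x + suc d)     ∎
  where open ≤-Reasoning

0<m≤n∸k⇒k+m≤n : ∀ m k n → 1 ≤ m → m ≤ n ∸ k → k + m ≤ n
0<m≤n∸k⇒k+m≤n m k n 1≤m m≤n∸k with k ≤? n
... | yes k≤n = ≤-trans (≤-reflexive (+-comm k m)) (m≤o∸n⇒m+n≤o m k≤n m≤n∸k)
... | no k≰n = ⊥-elim (<⇒≱ 1≤m (subst (m ≤_) (m≤n⇒m∸n≡0 (<⇒≤ (≰⇒> k≰n))) m≤n∸k))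

m<n⇒m≤n∸1 : ∀ {m n} → m < n → m ≤ n ∸ 1
m<n⇒m≤n∸1 {n = suc n} (s≤s m≤n) = m≤n

0<m≤n∸1⇒m<n : ∀ {m n} → 1 ≤ m → m ≤ n ∸ 1 → m < n
0<m≤n∸1⇒m<n {n = zero} 1≤m m≤0 = ⊥-elim (<⇒≱ 1≤m m≤0)
0<m≤n∸1⇒m<n {n = suc n} _ m≤n = s≤s m≤n

module BoundedSearch (P : ℕ → Set) (P? : ∀ k → Dec (P k)) where

  least : ∀ k → P k → ∃ λ j → P j × j ≤ k × (∀ j′ → j′ < j → ¬ P j′)
  least k pk with below k
    where
    below : ∀ N → (∀ j′ → j′ < N → ¬ P j′) ⊎ (∃ λ j → P j × j < N × (∀ j′ → j′ < j → ¬ P j′))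
    below zero = inj₁ (λ _ ())
    below (suc N) with below N
    ... | inj₂ (j , pj , j<N , none) = inj₂ (j , pj , m<n⇒m<1+n j<N , none)
    ... | inj₁ none with P? N
    ...   | yes pN = inj₂ (N , pN , ≤-refl , none)
    ...   | no ¬pN = inj₁ λ j′ j′<1+N → [ none j′ , (λ { refl → ¬pN }) ]′ (m<1+n⇒m<n∨m≡n j′<1+N)
  ... | inj₁ none = k , pk , ≤-refl , none
  ... | inj₂ (j , pj , j<k , none) = j , pj , <⇒≤ j<k , none

  greatest : ∀ N k → P k → k ≤ N → ∃ λ j → P j × k ≤ j × j ≤ N × (∀ j′ → j < j′ → j′ ≤ N → ¬ P j′)
  greatest zero k pk z≤n = 0 , pk , z≤n , z≤n , λ j′ 0<j′ j′≤0 → ⊥-elim (<⇒≱ 0<j′ j′≤0)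
  greatest (suc N) k pk k≤1+N with P? (suc N)
  ... | yes pN = suc N , pN , k≤1+N , ≤-refl , λ j′ 1+N<j′ j′≤1+N → ⊥-elim (<⇒≱ 1+N<j′ j′≤1+N)
  ... | no ¬pN with m≤n⇒m<n∨m≡n k≤1+N
  ...   | inj₂ refl = ⊥-elim (¬pN pk)
  ...   | inj₁ k<1+N with greatest N k pk (≤-pred k<1+N)
  ...     | j , pj , k≤j , j≤N , none = j , pj , k≤j , m≤n⇒m≤1+n j≤N , none′
    where
    none′ : ∀ j′ → j < j′ → j′ ≤ suc N → ¬ P j′
    none′ j′ j<j′ j′≤1+N with m≤n⇒m<n∨m≡n j′≤1+N
    ... | inj₂ refl = ¬pN
    ... | inj₁ j′<1+N = none j′ j<j′ (≤-pred j′<1+N)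

module Text {A : Set} (_≺_ : Rel A 0ℓ) (sto : IsStrictTotalOrder _≡_ _≺_) where
  open IsStrictTotalOrder sto using (irrefl; isStrictPartialOrder) renaming (trans to ≺-trans; _≟_ to _≟A_)
  open Strings _≟A_ public

  infix 4 _⊑_ _<L_

  _⊑_ : List A → List A → Set
  u ⊑ x = ∃ λ y → x ≡ u ++ y

  []⊑ : ∀ x → [] ⊑ x
  []⊑ x = x , refl

  ⊑-refl : ∀ u → u ⊑ u
  ⊑-refl u = [] , sym (List.++-identityʳ u)

  ∷-⊑ : ∀ c {u x} → u ⊑ x → c ∷ u ⊑ c ∷ x
  ∷-⊑ c (y , refl) = y , refl

  ∷-⊑⁻ : ∀ {c d u x} → c ∷ u ⊑ d ∷ x → c ≡ d × u ⊑ x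
  ∷-⊑⁻ (y , refl) = refl , y , refl

  ∷⋢[] : ∀ {c u} → ¬ c ∷ u ⊑ []
  ∷⋢[] (_ , ())

  ⊑-trans : ∀ {u v x} → u ⊑ v → v ⊑ x → u ⊑ x
  ⊑-trans {u} (y , refl) (z , refl) = y ++ z , List.++-assoc u y z

  ⊑⇒length≤ : ∀ {u x} → u ⊑ x → length u ≤ length x
  ⊑⇒length≤ {u} (y , refl) = ≤-trans (m≤m+n (length u) (length y)) (≤-reflexive (sym (List.length-++ u)))

  drop-⊑ : ∀ d {u x} → u ⊑ x → drop d u ⊑ drop d x
  drop-⊑ zero u⊑x = u⊑x
  drop-⊑ (suc d) {[]} _ = []⊑ _
  drop-⊑ (suc d) {c ∷ u} {[]} u⊑x = ⊥-elim (∷⋢[] u⊑x)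
  drop-⊑ (suc d) {c ∷ u} {_ ∷ _} u⊑x = drop-⊑ d (proj₂ (∷-⊑⁻ u⊑x))

  take-⊑ : ∀ m x → take m x ⊑ x
  take-⊑ m x = drop m x , sym (List.take++drop≡id m x)

  ⊑⇒take≡ : ∀ {u x} → u ⊑ x → take (length u) x ≡ u
  ⊑⇒take≡ {[]} _ = refl
  ⊑⇒take≡ {c ∷ u} {[]} u⊑x = ⊥-elim (∷⋢[] u⊑x)
  ⊑⇒take≡ {c ∷ u} {_ ∷ _} u⊑x with ∷-⊑⁻ u⊑x
  ... | refl , u⊑x′ = cong (c ∷_) (⊑⇒take≡ u⊑x′)

  ⊑-length-unique : ∀ {u v x} → u ⊑ x → v ⊑ x → length u ≡ length v → u ≡ v
  ⊑-length-unique {u} {v} {x} u⊑x v⊑x |u|≡|v| =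
    trans (sym (⊑⇒take≡ u⊑x)) (trans (cong (λ k → take k x) |u|≡|v|) (⊑⇒take≡ v⊑x))

  ++-⊑⁻ : ∀ u {v x} → u ++ v ⊑ x → u ⊑ x
  ++-⊑⁻ u {v} (y , refl) = v ++ y , List.++-assoc u v y

  ⊑-extend : ∀ {u x} → u ⊑ x → length u < length x → ∃ λ c → u ++ c ∷ [] ⊑ x
  ⊑-extend {[]} {c ∷ x} _ _ = c , x , refl
  ⊑-extend {a ∷ u} {[]} u⊑x _ = ⊥-elim (∷⋢[] u⊑x)
  ⊑-extend {a ∷ u} {_ ∷ _} u⊑x (s≤s |u|<|x|) with ∷-⊑⁻ u⊑x
  ... | refl , u⊑x′ with ⊑-extend u⊑x′ |u|<|x|
  ...   | c , u++c⊑x = c , ∷-⊑ a u++c⊑x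

  _⊑?_ : ∀ u x → Dec (u ⊑ x)
  [] ⊑? x = yes ([]⊑ x)
  (c ∷ u) ⊑? [] = no ∷⋢[]
  (c ∷ u) ⊑? (d ∷ x) with c ≟A d | u ⊑? x
  ... | yes refl | yes u⊑x = yes (∷-⊑ c u⊑x)
  ... | no c≢d | _ = no (λ cu⊑dx → c≢d (proj₁ (∷-⊑⁻ cu⊑dx)))
  ... | yes _ | no u⋢x = no (λ cu⊑dx → u⋢x (proj₂ (∷-⊑⁻ cu⊑dx)))

  length-++-[_] : ∀ (u : List A) c → length (u ++ c ∷ []) ≡ suc (length u)
  length-++-[ u ] c = trans (List.length-++ u) (+-comm (length u) 1)

  length-take : ∀ m (x : List A) → m ≤ length x → length (take m x) ≡ m
  length-take m x m≤|x| = trans (List.length-take m x) (m≤n⇒m⊓n≡m m≤|x|)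

  _<L_ : List A → List A → Set
  _<L_ = Lex-< _≡_ _≺_

  module <L = IsStrictPartialOrder (Lex-isStrictPartialOrder isStrictPartialOrder)

  <L-irrefl : ∀ x → ¬ x <L x
  <L-irrefl x = <L.irrefl (≡⇒Pointwise-≡ refl)

  ∷-<L⁻ : ∀ {c x y} → c ∷ x <L c ∷ y → x <L y
  ∷-<L⁻ (this c≺c) = ⊥-elim (irrefl refl c≺c)
  ∷-<L⁻ (next _ x<y) = x<y

  ⊑-<L-convex : ∀ u {x y z} → x <L y → y <L z → u ⊑ x → u ⊑ z → u ⊑ y
  ⊑-<L-convex [] _ _ _ _ = []⊑ _
  ⊑-<L-convex (c ∷ u) {x} {y} {z} x<y y<z (x′ , refl) (z′ , refl) = go x<y y<z
    where
    go : ∀ {y} → c ∷ u ++ x′ <L y → y <L c ∷ u ++ z′ → c ∷ u ⊑ y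
    go (this c≺d) (this d≺c) = ⊥-elim (irrefl refl (≺-trans c≺d d≺c))
    go (this c≺c) (next refl _) = ⊥-elim (irrefl refl c≺c)
    go (next refl _) (this c≺c) = ⊥-elim (irrefl refl c≺c)
    go (next refl x<y) (next refl y<z) = ∷-⊑ c (⊑-<L-convex u x<y y<z (x′ , refl) (z′ , refl))

  drop-∷⇒drop-suc : ∀ i (w : List A) {c x} → drop i w ≡ c ∷ x → drop (suc i) w ≡ x
  drop-∷⇒drop-suc zero (_ ∷ _) refl = refl
  drop-∷⇒drop-suc (suc i) (_ ∷ w) eq = drop-∷⇒drop-suc i w eq

  charAt-suc : ∀ w k → charAt w (suc k) ≡ head (drop k w)
  charAt-suc [] zero = refl
  charAt-suc [] (suc k) = refl
  charAt-suc (x ∷ w) zero = refl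
  charAt-suc (x ∷ w) (suc k) = charAt-suc w k

  charAt-suc⇒drop : ∀ w k {c} → charAt w (suc k) ≡ just c → drop k w ≡ c ∷ drop (suc k) w
  charAt-suc⇒drop w k eq with drop k w in eq′ | charAt-suc w k
  ... | [] | eq″ with () ← trans (sym eq) eq″
  ... | x ∷ _ | eq″ with refl ← trans (sym eq) eq″ = cong (x ∷_) (sym (drop-∷⇒drop-suc k w eq′))

  charAt-defined : ∀ (v : List A) k → 1 ≤ k → k ≤ length v → ∃ λ c → charAt v k ≡ just c
  charAt-defined (x ∷ v) (suc zero) _ _ = x , refl
  charAt-defined (x ∷ v) (suc (suc k)) _ (s≤s k<|v|) = charAt-defined v (suc k) (s≤s z≤n) k<|v|

  drop-nonempty : ∀ i (v : List A) → 1 ≤ length (drop (suc i) v) → ∃ λ c → drop i v ≡ c ∷ drop (suc i) v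
  drop-nonempty zero (c ∷ v) _ = c , refl
  drop-nonempty (suc i) (_ ∷ v) nonempty = drop-nonempty i v nonempty

  sub≡take-suffix : ∀ w k m → sub w (suc k) (suc k + m ∸ 1) ≡ take m (drop k w)
  sub≡take-suffix w k m = cong (λ t → take t (drop k w)) (m+n∸m≡n k m)

  OccursAt⇒⊑ : ∀ {w u k} → OccursAt w u k → 1 ≤ k × 1 ≤ length u × u ⊑ suffix w k
  OccursAt⇒⊑ {w} {u} {suc k} (1≤k , 1≤|u| , _ , u≡sub) =
    1≤k , 1≤|u| ,
    subst (_⊑ drop k w) (sym (trans u≡sub (sub≡take-suffix w k (length u)))) (take-⊑ (length u) (drop k w))

  ⊑⇒OccursAt : ∀ {w u k} → 1 ≤ k → 1 ≤ length u → u ⊑ suffix w k → OccursAt w u k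
  ⊑⇒OccursAt {w} {u} {suc k} 1≤k 1≤|u| u⊑ =
    1≤k , 1≤|u| , in-bounds , sym (trans (sub≡take-suffix w k (length u)) (⊑⇒take≡ u⊑))
    where
    |u|≤|w|∸k : length u ≤ length w ∸ k
    |u|≤|w|∸k = ≤-trans (⊑⇒length≤ u⊑) (≤-reflexive (List.length-drop k w))
    in-bounds : suc k + length u ∸ 1 ≤ length w
    in-bounds = 0<m≤n∸k⇒k+m≤n (length u) k (length w) 1≤|u| |u|≤|w|∸k

  OccursAt⇒bounded : ∀ {w u k} → OccursAt w u k → 1 ≤ k × k ≤ length w
  OccursAt⇒bounded {w} {u} {suc k} (1≤k , 1≤|u| , in-bounds , _) =
    1≤k , ≤-trans (subst (_≤ k + length u) (+-comm k 1) (+-monoʳ-≤ k 1≤|u|)) in-bounds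

  occurrences : List A → List A → List ℕ
  occurrences w u = filter (occursAt? w u) (range 1 (length w))

  ∈-occurrences⁺ : ∀ {w u k} → OccursAt w u k → k ∈ occurrences w u
  ∈-occurrences⁺ {w} {u} o with OccursAt⇒bounded o
  ... | 1≤k , k≤|w| = ∈-filter⁺ (occursAt? w u) (∈-range⁺ 1≤k k≤|w|) o

  ∈-occurrences⁻ : ∀ {w u k} → k ∈ occurrences w u → OccursAt w u k
  ∈-occurrences⁻ {w} {u} k∈ = proj₂ (∈-filter⁻ (occursAt? w u) {xs = range 1 (length w)} k∈)

  occurrences-unique : ∀ w u → Unique (occurrences w u)
  occurrences-unique w u = Unique.filter⁺ (occursAt? w u) (range-unique 1 (length w))

  occ-≥ : ∀ {w u} {ks : List ℕ} → Unique ks → (∀ {k} → k ∈ ks → OccursAt w u k) → length ks ≤ occ w u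
  occ-≥ uks occurs = Unique⊆⇒length≤ uks (λ k∈ → ∈-occurrences⁺ (occurs k∈))

  occ-antitone : ∀ w {v y} d → OccursAt v y (suc d) → occ w v ≤ occ w y
  occ-antitone w {v} {y} d y-in-v =
    ≤-trans (≤-reflexive (sym (List.length-map (_+ d) (occurrences w v)))) (occ-≥ shifted-unique shifted-occurs)
    where
    shifted-unique : Unique (map (_+ d) (occurrences w v))
    shifted-unique = Unique.map⁺ (+-cancelʳ-≡ d _ _) (occurrences-unique w v)
    shift : ∀ k → OccursAt w v k → OccursAt w y (k + d)
    shift (suc k) o with OccursAt⇒⊑ y-in-v | OccursAt⇒⊑ o
    ... | _ , 1≤|y| , y⊑ | _ , _ , v⊑ =
      ⊑⇒OccursAt (s≤s z≤n) 1≤|y| (subst (y ⊑_) (List.drop-drop k d w) (⊑-trans y⊑ (drop-⊑ d v⊑)))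
    shifted-occurs : ∀ {k} → k ∈ map (_+ d) (occurrences w v) → OccursAt w y k
    shifted-occurs k∈ with ∈-map⁻ (_+ d) k∈
    ... | k₀ , k₀∈ , refl = shift k₀ (∈-occurrences⁻ k₀∈)

  IsExtension⇒one-letter : ∀ w u v → IsExtension u v →
    ∃ λ c → occ w v ≤ occ w (c ∷ u) ⊎ occ w v ≤ occ w (u ++ c ∷ [])
  IsExtension⇒one-letter w u v ((suc zero , o) , u≢v) with OccursAt⇒⊑ {v} {u} {1} o
  ... | _ , _ , [] , eq = ⊥-elim (u≢v (sym (trans eq (List.++-identityʳ u))))
  ... | _ , 1≤|u| , c ∷ z , eq = c , inj₂ (occ-antitone w 0
        (⊑⇒OccursAt (s≤s z≤n) (subst (1 ≤_) (sym (length-++-[ u ] c)) (s≤s z≤n))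
          (z , trans eq (sym (List.++-assoc u (c ∷ []) z)))))
  IsExtension⇒one-letter w u v ((suc (suc i) , o) , _) with OccursAt⇒⊑ {v} {u} {suc (suc i)} o
  ... | _ , 1≤|u| , u⊑ with drop-nonempty i v (≤-trans 1≤|u| (⊑⇒length≤ u⊑))
  ...   | c , eq = c , inj₁ (occ-antitone w i
          (⊑⇒OccursAt (s≤s z≤n) (s≤s z≤n) (subst (c ∷ u ⊑_) (sym eq) (∷-⊑ c u⊑))))

  IsExtension-∷ : ∀ u c → 1 ≤ length u → IsExtension u (c ∷ u)
  IsExtension-∷ u c 1≤|u| =
    (2 , ⊑⇒OccursAt {c ∷ u} (s≤s z≤n) 1≤|u| (⊑-refl u)) ,
    λ u≡cu → m≢1+m+n (length u) (trans (cong length u≡cu) (cong suc (sym (+-identityʳ (length u)))))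

  IsExtension-++-[_] : ∀ u c → 1 ≤ length u → IsExtension u (u ++ c ∷ [])
  IsExtension-++-[ u ] c 1≤|u| =
    (1 , ⊑⇒OccursAt (s≤s z≤n) 1≤|u| (c ∷ [] , refl)) ,
    λ u≡uc → m≢1+m+n (length u) (trans (cong length u≡uc) (trans (length-++-[ u ] c) (cong suc (sym (+-identityʳ (length u))))))

  one-letter-maximal⇒MaximalRepeat : ∀ w u → 2 ≤ occ w u
    → (∀ c → occ w (c ∷ u) < occ w u) → (∀ c → occ w (u ++ c ∷ []) < occ w u) → MaximalRepeat w u
  one-letter-maximal⇒MaximalRepeat w u 2≤occ left right = 2≤occ , λ v ext → fewer (IsExtension⇒one-letter w u v ext)
    where
    fewer : ∀ {v} → (∃ λ c → occ w v ≤ occ w (c ∷ u) ⊎ occ w v ≤ occ w (u ++ c ∷ [])) → occ w v < occ w u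
    fewer (c , inj₁ ≤left) = ≤-<-trans ≤left (left c)
    fewer (c , inj₂ ≤right) = ≤-<-trans ≤right (right c)

  occ-++-[]< : ∀ w u c k → OccursAt w u k → ¬ OccursAt w (u ++ c ∷ []) k → occ w (u ++ c ∷ []) < occ w u
  occ-++-[]< w u c k u-at-k ¬uc-at-k = occ-≥ {ks = k ∷ occurrences w (u ++ c ∷ [])}
      (All.tabulate (λ k′∈ k≡k′ → ¬uc-at-k (subst (OccursAt w (u ++ c ∷ [])) (sym k≡k′) (∈-occurrences⁻ k′∈)))
        ∷ occurrences-unique w (u ++ c ∷ []))
      u-occurs
    where
    u-occurs : ∀ {k′} → k′ ∈ k ∷ occurrences w (u ++ c ∷ []) → OccursAt w u k′
    u-occurs (here refl) = u-at-k
    u-occurs (there k′∈) with OccursAt⇒⊑ (∈-occurrences⁻ {w} {u ++ c ∷ []} k′∈)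
    ... | 1≤k′ , _ , uc⊑ = ⊑⇒OccursAt 1≤k′ (proj₁ (proj₂ (OccursAt⇒⊑ u-at-k))) (++-⊑⁻ u uc⊑)

  NotPrecededBy : List A → A → ℕ → Set
  NotPrecededBy w c k = k ≡ 1 ⊎ charAt w (k ∸ 1) ≢ just c

  notPrecededBy? : ∀ w c k → Dec (NotPrecededBy w c k)
  notPrecededBy? w c k with k ≟ 1 | Maybe.≡-dec _≟A_ (charAt w (k ∸ 1)) (just c)
  ... | yes k≡1 | _ = yes (inj₁ k≡1)
  ... | no _ | no ¬c = yes (inj₂ ¬c)
  ... | no k≢1 | yes c = no λ { (inj₁ k≡1) → k≢1 k≡1 ; (inj₂ ¬c) → ¬c c }

  occ-∷< : ∀ w u c k → OccursAt w u k → NotPrecededBy w c k → occ w (c ∷ u) < occ w u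
  occ-∷< w u c k u-at-k k-unpreceded =
    ≤-trans (s≤s (≤-reflexive (sym (List.length-map suc (occurrences w (c ∷ u))))))
      (occ-≥ {ks = k ∷ map suc (occurrences w (c ∷ u))}
        (All.map⁺ (All.tabulate (λ k′∈ → k≢1+ _ (∈-occurrences⁻ k′∈) k-unpreceded))
          ∷ Unique.map⁺ suc-injective (occurrences-unique w (c ∷ u)))
        u-occurs)
    where
    k≢1+ : ∀ k′ → OccursAt w (c ∷ u) k′ → NotPrecededBy w c k → k ≢ suc k′
    k≢1+ (suc k″) _ (inj₁ ()) refl
    k≢1+ (suc k″) o (inj₂ ¬c) refl with OccursAt⇒⊑ o
    ... | _ , _ , cu⊑ with drop k″ w | charAt-suc w k″
    ...   | [] | _ = ∷⋢[] cu⊑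
    ...   | _ ∷ _ | eq = ¬c (trans eq (cong just (sym (proj₁ (∷-⊑⁻ cu⊑)))))
    shift : ∀ k₀ → OccursAt w (c ∷ u) k₀ → OccursAt w u (suc k₀)
    shift (suc k₁) o with OccursAt⇒⊑ o
    ... | _ , _ , cu⊑ with drop k₁ w in eq
    ...   | [] = ⊥-elim (∷⋢[] cu⊑)
    ...   | _ ∷ _ = ⊑⇒OccursAt {w} (s≤s z≤n) (proj₁ (proj₂ (OccursAt⇒⊑ u-at-k)))
                      (subst (u ⊑_) (sym (drop-∷⇒drop-suc k₁ w eq)) (proj₂ (∷-⊑⁻ cu⊑)))
    u-occurs : ∀ {k′} → k′ ∈ k ∷ map suc (occurrences w (c ∷ u)) → OccursAt w u k′
    u-occurs (here refl) = u-at-k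
    u-occurs (there k′∈) with ∈-map⁻ suc k′∈
    ... | k₀ , k₀∈ , refl = shift k₀ (∈-occurrences⁻ k₀∈)

  occ-∷<⇒NotPrecededBy : ∀ w u c → occ w (c ∷ u) < occ w u → ∃ λ k → OccursAt w u k × NotPrecededBy w c k
  occ-∷<⇒NotPrecededBy w u c fewer with any? (notPrecededBy? w c) (occurrences w u)
  ... | yes some with find some
  ...   | k , k∈ , unpreceded = k , ∈-occurrences⁻ k∈ , unpreceded
  occ-∷<⇒NotPrecededBy w u c fewer | no none = ⊥-elim (<⇒≱ fewer
      (≤-trans (≤-reflexive (sym (List.length-map pred (occurrences w u))))
        (occ-≥ (map-unique-on pred (occurrences w u) (occurrences-unique w u) pred-injective-on) cu-occurs)))
    where
    preceded : ∀ k → k ∈ occurrences w u → ∃ λ k₂ → k ≡ suc (suc k₂) × charAt w (suc k₂) ≡ just c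
    preceded zero k∈ = ⊥-elim (<⇒≱ (proj₁ (OccursAt⇒bounded (∈-occurrences⁻ {w} {u} k∈))) z≤n)
    preceded (suc zero) k∈ = ⊥-elim (All.lookup (All.¬Any⇒All¬ _ none) k∈ (inj₁ refl))
    preceded (suc (suc k₂)) k∈ with Maybe.≡-dec _≟A_ (charAt w (suc k₂)) (just c)
    ... | yes eq = k₂ , refl , eq
    ... | no ¬c = ⊥-elim (All.lookup (All.¬Any⇒All¬ _ none) k∈ (inj₂ ¬c))
    pred-injective-on : ∀ {x y} → x ∈ occurrences w u → y ∈ occurrences w u → pred x ≡ pred y → x ≡ y
    pred-injective-on x∈ y∈ eq with preceded _ x∈ | preceded _ y∈
    ... | _ , refl , _ | _ , refl , _ = cong suc eq
    cu-occurs : ∀ {k} → k ∈ map pred (occurrences w u) → OccursAt w (c ∷ u) k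
    cu-occurs k∈ with ∈-map⁻ pred k∈
    ... | k₀ , k₀∈ , refl with preceded _ k₀∈ | OccursAt⇒⊑ (∈-occurrences⁻ {w} {u} k₀∈)
    ...   | k₂ , refl , eq | _ , _ , u⊑ =
      ⊑⇒OccursAt (s≤s z≤n) (s≤s z≤n) (subst (c ∷ u ⊑_) (sym (charAt-suc⇒drop w k₂ eq)) (∷-⊑ c u⊑))

  lcp≤length : ∀ x y → lcp x y ≤ length x
  lcp≤length [] y = z≤n
  lcp≤length (a ∷ x) [] = z≤n
  lcp≤length (a ∷ x) (b ∷ y) with a ≟A b
  ... | yes _ = s≤s (lcp≤length x y)
  ... | no _ = z≤n

  ⊑-lcpʳ : ∀ u x y → length u ≤ lcp x y → u ⊑ x → u ⊑ y
  ⊑-lcpʳ [] x y _ _ = []⊑ y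
  ⊑-lcpʳ (c ∷ u) x y |u|≤ u⊑x with x | y | |u|≤
  ... | a ∷ x′ | b ∷ y′ | |u|≤′ with a ≟A b | |u|≤′
  ...   | yes refl | s≤s |u|≤″ with ∷-⊑⁻ u⊑x
  ...     | refl , u⊑x′ = ∷-⊑ c (⊑-lcpʳ u x′ y′ |u|≤″ u⊑x′)

  ⊑-lcpˡ : ∀ u x y → length u ≤ lcp x y → u ⊑ y → u ⊑ x
  ⊑-lcpˡ [] x y _ _ = []⊑ x
  ⊑-lcpˡ (c ∷ u) x y |u|≤ u⊑y with x | y | |u|≤
  ... | a ∷ x′ | b ∷ y′ | |u|≤′ with a ≟A b | |u|≤′
  ...   | yes refl | s≤s |u|≤″ with ∷-⊑⁻ u⊑y
  ...     | refl , u⊑y′ = ∷-⊑ c (⊑-lcpˡ u x′ y′ |u|≤″ u⊑y′)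

  ⊑-both⇒≤lcp : ∀ u x y → u ⊑ x → u ⊑ y → length u ≤ lcp x y
  ⊑-both⇒≤lcp [] x y _ _ = z≤n
  ⊑-both⇒≤lcp (c ∷ u) [] y u⊑x _ = ⊥-elim (∷⋢[] u⊑x)
  ⊑-both⇒≤lcp (c ∷ u) (a ∷ x) [] _ u⊑y = ⊥-elim (∷⋢[] u⊑y)
  ⊑-both⇒≤lcp (c ∷ u) (a ∷ x) (b ∷ y) u⊑x u⊑y with ∷-⊑⁻ u⊑x | ∷-⊑⁻ u⊑y
  ... | refl , u⊑x′ | refl , u⊑y′ with c ≟A c
  ...   | yes _ = s≤s (⊑-both⇒≤lcp u x y u⊑x′ u⊑y′)
  ...   | no c≢c = ⊥-elim (c≢c refl)

  maxBelow-spec : ∀ i S → maxBelow i S ≡ 0 ⊎ (maxBelow i S ∈ S × maxBelow i S < i)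
  maxBelow-spec i [] = inj₁ refl
  maxBelow-spec i (j ∷ S) with j <ᵇ i in j<ᵇi
  ... | false = Sum.map₂ (Product.map₁ there) (maxBelow-spec i S)
  ... | true with ⊔-sel j (maxBelow i S)
  ...   | inj₁ eq rewrite eq = inj₂ (here refl , <ᵇ⇒< j i (subst T (sym j<ᵇi) _))
  ...   | inj₂ eq rewrite eq = Sum.map₂ (Product.map₁ there) (maxBelow-spec i S)

  maxBelow-greatest : ∀ i S {j} → j ∈ S → j < i → j ≤ maxBelow i S
  maxBelow-greatest i (j ∷ S) (here refl) j<i with j <ᵇ i in j<ᵇi
  ... | true = m≤m⊔n j (maxBelow i S)
  ... | false = ⊥-elim (subst T j<ᵇi (<⇒<ᵇ j<i))
  maxBelow-greatest i (k ∷ S) (there j∈S) j<i with k <ᵇ i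
  ... | true = ≤-trans (maxBelow-greatest i S j∈S j<i) (m≤n⊔m k (maxBelow i S))
  ... | false = maxBelow-greatest i S j∈S j<i

  minAbove-spec : ∀ d i S → minAbove d i S ≡ d ⊎ (minAbove d i S ∈ S × i < minAbove d i S)
  minAbove-spec d i [] = inj₁ refl
  minAbove-spec d i (j ∷ S) with i <ᵇ j in i<ᵇj
  ... | false = Sum.map₂ (Product.map₁ there) (minAbove-spec d i S)
  ... | true with ⊓-sel j (minAbove d i S)
  ...   | inj₁ eq rewrite eq = inj₂ (here refl , <ᵇ⇒< i j (subst T (sym i<ᵇj) _))
  ...   | inj₂ eq rewrite eq = Sum.map₂ (Product.map₁ there) (minAbove-spec d i S)

  minAbove-least : ∀ d i S {j} → j ∈ S → i < j → minAbove d i S ≤ j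
  minAbove-least d i (j ∷ S) (here refl) i<j with i <ᵇ j in i<ᵇj
  ... | true = m⊓n≤m j (minAbove d i S)
  ... | false = ⊥-elim (subst T i<ᵇj (<⇒<ᵇ i<j))
  minAbove-least d i (k ∷ S) (there j∈S) i<j with i <ᵇ k
  ... | true = ≤-trans (m⊓n≤n k (minAbove d i S)) (minAbove-least d i S j∈S i<j)
  ... | false = minAbove-least d i S j∈S i<j

  minAbove≤default : ∀ d i S → minAbove d i S ≤ d
  minAbove≤default d i [] = ≤-refl
  minAbove≤default d i (j ∷ S) with i <ᵇ j
  ... | true = ≤-trans (m⊓n≤n j (minAbove d i S)) (minAbove≤default d i S)
  ... | false = minAbove≤default d i S

  T-eqChar : ∀ x y → T (eqChar x y) ⇔ x ≡ y
  T-eqChar x y with Maybe.≡-dec _≟A_ x y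
  ... | yes x≡y = mk⇔ (λ _ → x≡y) (λ _ → _)
  ... | no x≢y = mk⇔ (λ ()) x≢y

  module SuffixArray (w : List A) (r p : ℕ → ℕ) (sa : IsSuffixArray _≺_ w r) (inv : IsInverse w r p) where

    n : ℕ
    n = length w

    s : ℕ → List A
    s j = suffix w (r j)

    L : ℕ → ℕ
    L t = lcp (s t) (s (suc t))

    r-bounded : ∀ j → 1 ≤ j → j ≤ n → 1 ≤ r j × r j ≤ n
    r-bounded = proj₁ sa

    s-increasing : ∀ i j → 1 ≤ i → i < j → j ≤ n → s i <L s j
    s-increasing = proj₂ sa

    s-<L⇒< : ∀ a b → 1 ≤ a → a ≤ n → 1 ≤ b → b ≤ n → s a <L s b → a < b
    s-<L⇒< a b 1≤a a≤n 1≤b b≤n sa<sb with <-cmp a b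
    ... | tri< a<b _ _ = a<b
    ... | tri≈ _ refl _ = ⊥-elim (<L-irrefl _ sa<sb)
    ... | tri> _ _ b<a = ⊥-elim (<L-irrefl _ (<L.trans sa<sb (s-increasing b a 1≤b b<a a≤n)))

    r-injective : ∀ a b → 1 ≤ a → a ≤ n → 1 ≤ b → b ≤ n → r a ≡ r b → a ≡ b
    r-injective a b 1≤a a≤n 1≤b b≤n ra≡rb = trans (sym (inv a 1≤a a≤n)) (trans (cong p ra≡rb) (inv b 1≤b b≤n))

    -- r maps {1..n} injectively into itself, hence onto it.
    r-surjective : ∀ k → 1 ≤ k → k ≤ n → ∃ λ j → 1 ≤ j × j ≤ n × r j ≡ k
    r-surjective k 1≤k k≤n with any? (λ j → r j ≟ k) (range 1 n)
    ... | yes some with find some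
    ...   | j , j∈ , rj≡k = j , proj₁ (∈-range⁻ j∈) , proj₂ (∈-range⁻ j∈) , rj≡k
    r-surjective k 1≤k k≤n | no none = ⊥-elim (<⇒≱ (s≤s ≤-refl) n+1≤n)
      where
      image-unique : Unique (k ∷ map r (range 1 n))
      image-unique =
        All.map⁺ (All.tabulate (λ j∈ k≡rj → All.lookup (All.¬Any⇒All¬ _ none) j∈ (sym k≡rj)))
        ∷ map-unique-on r (range 1 n) (range-unique 1 n)
            (λ x∈ y∈ → r-injective _ _ (proj₁ (∈-range⁻ x∈)) (proj₂ (∈-range⁻ x∈))
                                        (proj₁ (∈-range⁻ y∈)) (proj₂ (∈-range⁻ y∈)))
      image-⊆ : ∀ {x} → x ∈ k ∷ map r (range 1 n) → x ∈ range 1 n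
      image-⊆ (here refl) = ∈-range⁺ 1≤k k≤n
      image-⊆ (there x∈) with ∈-map⁻ r x∈
      ... | j , j∈ , refl = let (1≤rj , rj≤n) = r-bounded j (proj₁ (∈-range⁻ j∈)) (proj₂ (∈-range⁻ j∈))
                            in ∈-range⁺ 1≤rj rj≤n
      n+1≤n : suc n ≤ n
      n+1≤n = begin
        suc n                              ≡⟨ cong suc (trans (List.length-map r (range 1 n)) (length-range 1 n)) ⟨
        length (k ∷ map r (range 1 n))     ≤⟨ Unique⊆⇒length≤ image-unique image-⊆ ⟩
        length (range 1 n)                 ≡⟨ length-range 1 n ⟩
        n                                  ∎
        where open ≤-Reasoning

    r∘p : ∀ k → 1 ≤ k → k ≤ n → r (p k) ≡ k × 1 ≤ p k × p k ≤ n
    r∘p k 1≤k k≤n with r-surjective k 1≤k k≤n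
    ... | j , 1≤j , j≤n , refl rewrite inv j 1≤j j≤n = refl , 1≤j , j≤n

    ⊑-s-convex : ∀ v a j b → 1 ≤ a → a ≤ j → j ≤ b → b ≤ n → v ⊑ s a → v ⊑ s b → v ⊑ s j
    ⊑-s-convex v a j b 1≤a a≤j j≤b b≤n v⊑sa v⊑sb with m≤n⇒m<n∨m≡n a≤j | m≤n⇒m<n∨m≡n j≤b
    ... | inj₂ refl | _ = v⊑sa
    ... | inj₁ _ | inj₂ refl = v⊑sb
    ... | inj₁ a<j | inj₁ j<b =
      ⊑-<L-convex v (s-increasing a j 1≤a a<j (≤-trans j≤b b≤n)) (s-increasing j b (≤-trans 1≤a a≤j) j<b b≤n) v⊑sa v⊑sb

    OccursAt⇒rank : ∀ {u k} → OccursAt w u k → ∃ λ j → 1 ≤ j × j ≤ n × r j ≡ k × u ⊑ s j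
    OccursAt⇒rank {u} {k} o with OccursAt⇒bounded o | OccursAt⇒⊑ {w} {u} {k} o
    ... | 1≤k , k≤n | _ , _ , u⊑ with r-surjective k 1≤k k≤n
    ...   | j , 1≤j , j≤n , refl = j , 1≤j , j≤n , refl , u⊑

    rank⇒OccursAt : ∀ {u j} → 1 ≤ j → j ≤ n → 1 ≤ length u → u ⊑ s j → OccursAt w u (r j)
    rank⇒OccursAt {u} {j} 1≤j j≤n = ⊑⇒OccursAt {w} {u} {r j} (proj₁ (r-bounded j 1≤j j≤n))

    record Interval (u : List A) (a b : ℕ) : Set where
      field
        ⊑-inside : ∀ j → a ≤ j → j ≤ b → u ⊑ s j
        ⊑⇒inside : ∀ j → 1 ≤ j → j ≤ n → u ⊑ s j → a ≤ j × j ≤ b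

    Preceded : A → ℕ → Set
    Preceded c j = 2 ≤ r j × charAt w (r j ∸ 1) ≡ just c

    AllPreceded : A → ℕ → ℕ → Set
    AllPreceded c a b = ∀ j → a ≤ j → j ≤ b → Preceded c j

    -- The ranks of the suffixes one letter longer and one letter shorter than s j.
    longer : ℕ → ℕ
    longer j = p (r j ∸ 1)

    shorter : ℕ → ℕ
    shorter j = p (suc (r j))

    longer-spec : ∀ j c → 1 ≤ j → j ≤ n → Preceded c j →
      1 ≤ longer j × longer j ≤ n × r (longer j) ≡ r j ∸ 1 × s (longer j) ≡ c ∷ s j
    longer-spec j c 1≤j j≤n (2≤rj , c-before) = go (r j) 2≤rj (proj₂ (r-bounded j 1≤j j≤n)) c-before
      where
      go : ∀ k → 2 ≤ k → k ≤ n → charAt w (k ∸ 1) ≡ just c →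
        1 ≤ p (k ∸ 1) × p (k ∸ 1) ≤ n × r (p (k ∸ 1)) ≡ k ∸ 1 × suffix w (r (p (k ∸ 1))) ≡ c ∷ suffix w k
      go (suc (suc k)) (s≤s (s≤s z≤n)) k+2≤n c-before with r∘p (suc k) (s≤s z≤n) (≤-trans (n≤1+n _) k+2≤n)
      ... | rp≡ , 1≤p , p≤n = 1≤p , p≤n , rp≡ , trans (cong (suffix w) rp≡) (charAt-suc⇒drop w k c-before)

    shorter-spec : ∀ j c u → 1 ≤ j → j ≤ n → 1 ≤ length u → c ∷ u ⊑ s j →
      1 ≤ shorter j × shorter j ≤ n × r (shorter j) ≡ suc (r j)
      × s j ≡ c ∷ s (shorter j) × u ⊑ s (shorter j) × charAt w (r j) ≡ just c
    shorter-spec j c u 1≤j j≤n 1≤|u| cu⊑ = go (r j) (proj₁ (r-bounded j 1≤j j≤n)) cu⊑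
      where
      go : ∀ k → 1 ≤ k → c ∷ u ⊑ suffix w k →
        1 ≤ p (suc k) × p (suc k) ≤ n × r (p (suc k)) ≡ suc k
        × suffix w k ≡ c ∷ suffix w (r (p (suc k))) × u ⊑ suffix w (r (p (suc k))) × charAt w k ≡ just c
      go (suc k) _ cu⊑ with drop k w in eq
      ... | [] = ⊥-elim (∷⋢[] cu⊑)
      ... | _ ∷ _ with ∷-⊑⁻ cu⊑
      ...   | refl , u⊑ with r∘p (suc (suc k)) (s≤s z≤n) k+2≤n
        where
        k+2≤n : suc (suc k) ≤ n
        k+2≤n = subst (_≤ n) (+-comm k 2) (0<m≤n∸k⇒k+m≤n 2 k n (s≤s z≤n)
                  (≤-trans (s≤s 1≤|u|) (≤-trans (⊑⇒length≤ cu⊑) (≤-reflexive (trans (cong length (sym eq)) (List.length-drop k w))))))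
      ...     | rp≡ , 1≤p , p≤n =
        1≤p , p≤n , rp≡ , cong (c ∷_) tail≡ , subst (u ⊑_) tail≡ u⊑ , trans (charAt-suc w k) (cong head eq)
        where
        tail≡ : _ ≡ suffix w (r (p (suc (suc k))))
        tail≡ = trans (sym (drop-∷⇒drop-suc k w eq)) (cong (suffix w) (sym rp≡))

    shorter∘longer : ∀ j c → 1 ≤ j → j ≤ n → Preceded c j → shorter (longer j) ≡ j
    shorter∘longer j c 1≤j j≤n pre@(2≤rj , _) with longer-spec j c 1≤j j≤n pre
    ... | _ , _ , rl≡ , _ = begin
      p (suc (r (longer j)))   ≡⟨ cong (λ x → p (suc x)) rl≡ ⟩
      p (suc (r j ∸ 1))        ≡⟨ cong p (m+[n∸m]≡n (≤-trans (s≤s z≤n) 2≤rj)) ⟩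
      p (r j)                  ≡⟨ inv j 1≤j j≤n ⟩
      j                        ∎
      where open ≡-Reasoning

    longer-increasing : ∀ c a₀ b₀ → 1 ≤ a₀ → b₀ ≤ n → AllPreceded c a₀ b₀
      → ∀ a b → a₀ ≤ a → a < b → b ≤ b₀ → longer a < longer b
    longer-increasing c a₀ b₀ 1≤a₀ b₀≤n pre a b a₀≤a a<b b≤b₀
      with longer-spec a c 1≤a a≤n (pre a a₀≤a (<⇒≤ a<b′)) | longer-spec b c 1≤b b≤n (pre b (≤-trans a₀≤a (<⇒≤ a<b)) b≤b₀)
      where
      1≤a = ≤-trans 1≤a₀ a₀≤a
      1≤b = ≤-trans 1≤a (<⇒≤ a<b)
      b≤n = ≤-trans b≤b₀ b₀≤n
      a≤n = ≤-trans (<⇒≤ a<b) b≤n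
      a<b′ = <-≤-trans a<b b≤b₀
    ... | 1≤la , la≤n , _ , sla≡ | 1≤lb , lb≤n , _ , slb≡ =
      s-<L⇒< _ _ 1≤la la≤n 1≤lb lb≤n
        (subst₂ _<L_ (sym sla≡) (sym slb≡) (next refl (s-increasing a b (≤-trans 1≤a₀ a₀≤a) a<b (≤-trans b≤b₀ b₀≤n))))

    shorter-increasing : ∀ c u x y → 1 ≤ x → y ≤ n → 1 ≤ length u → (∀ j → x ≤ j → j ≤ y → c ∷ u ⊑ s j)
      → ∀ a b → x ≤ a → a < b → b ≤ y → shorter a < shorter b
    shorter-increasing c u x y 1≤x y≤n 1≤|u| cu⊑ a b x≤a a<b b≤y
      with shorter-spec a c u 1≤a a≤n 1≤|u| (cu⊑ a x≤a (≤-trans (<⇒≤ a<b) b≤y))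
         | shorter-spec b c u 1≤b b≤n 1≤|u| (cu⊑ b (≤-trans x≤a (<⇒≤ a<b)) b≤y)
      where
      1≤a = ≤-trans 1≤x x≤a
      1≤b = ≤-trans 1≤a (<⇒≤ a<b)
      b≤n = ≤-trans b≤y y≤n
      a≤n = ≤-trans (<⇒≤ a<b) b≤n
    ... | 1≤sa , sa≤n , _ , s≡a , _ | 1≤sb , sb≤n , _ , s≡b , _ =
      s-<L⇒< _ _ 1≤sa sa≤n 1≤sb sb≤n
        (∷-<L⁻ (subst₂ _<L_ s≡a s≡b (s-increasing a b (≤-trans 1≤x x≤a) a<b (≤-trans b≤y y≤n))))

    ⊑-between-longer : ∀ u c a b → 1 ≤ a → a ≤ b → b ≤ n → Interval u a b → Preceded c a → Preceded c b
      → ∀ j → longer a ≤ j → j ≤ longer b → c ∷ u ⊑ s j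
    ⊑-between-longer u c a b 1≤a a≤b b≤n ins pre-a pre-b j la≤j j≤lb
      with longer-spec a c 1≤a (≤-trans a≤b b≤n) pre-a | longer-spec b c (≤-trans 1≤a a≤b) b≤n pre-b
    ... | 1≤la , _ , _ , sla≡ | _ , lb≤n , _ , slb≡ =
      ⊑-s-convex (c ∷ u) (longer a) j (longer b) 1≤la la≤j j≤lb lb≤n
        (subst (c ∷ u ⊑_) (sym sla≡) (∷-⊑ c (⊑-inside a ≤-refl a≤b)))
        (subst (c ∷ u ⊑_) (sym slb≡) (∷-⊑ c (⊑-inside b a≤b ≤-refl)))
      where open Interval ins

    -- longer maps [a, b] increasingly into [longer a, longer b], and shorter maps that range
    -- increasingly back into [a, b]; so both ranges have the same length.
    AllPreceded⇒longer-shift : ∀ u c a b → 1 ≤ a → a ≤ b → b ≤ n → 1 ≤ length u → Interval u a b → AllPreceded c a b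
      → longer b ≡ longer a + (b ∸ a)
    AllPreceded⇒longer-shift u c a b 1≤a a≤b b≤n 1≤|u| ins pre = ≤-antisym upper lower
      where
      pre-a = pre a ≤-refl a≤b
      pre-b = pre b a≤b ≤-refl
      a+[b∸a]≡b = m+[n∸m]≡n a≤b
      lower : longer a + (b ∸ a) ≤ longer b
      lower = ≤-trans (strictlyIncreasing⇒+≤ longer a b (longer-increasing c a b 1≤a b≤n pre) (b ∸ a) (≤-reflexive a+[b∸a]≡b))
                      (≤-reflexive (cong longer a+[b∸a]≡b))
      E = longer b ∸ longer a
      la+E≡lb : longer a + E ≡ longer b
      la+E≡lb = m+[n∸m]≡n (≤-trans (m≤m+n (longer a) (b ∸ a)) lower)
      shorter-stretch : shorter (longer a) + E ≤ shorter (longer b)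
      shorter-stretch = ≤-trans
        (strictlyIncreasing⇒+≤ shorter (longer a) (longer b)
          (shorter-increasing c u (longer a) (longer b)
            (proj₁ (longer-spec a c 1≤a (≤-trans a≤b b≤n) pre-a)) (proj₁ (proj₂ (longer-spec b c (≤-trans 1≤a a≤b) b≤n pre-b)))
            1≤|u| (⊑-between-longer u c a b 1≤a a≤b b≤n ins pre-a pre-b))
          E (≤-reflexive la+E≡lb))
        (≤-reflexive (cong shorter la+E≡lb))
      a+E≤b : a + E ≤ b
      a+E≤b = subst₂ (λ x y → x + E ≤ y)
        (shorter∘longer a c 1≤a (≤-trans a≤b b≤n) pre-a) (shorter∘longer b c (≤-trans 1≤a a≤b) b≤n pre-b) shorter-stretch
      upper : longer b ≤ longer a + (b ∸ a)
      upper = ≤-trans (≤-reflexive (sym la+E≡lb)) (+-monoʳ-≤ (longer a) (m+n≤o⇒m≤o∸n E (subst (_≤ b) (+-comm a E) a+E≤b)))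

    -- Conversely, if longer shifts [a, b] rigidly then shorter is a bijection between the two ranges,
    -- so every s j with j ∈ [a, b] is obtained by dropping c from a suffix.
    longer-shift⇒AllPreceded : ∀ u c a b → 1 ≤ a → a ≤ b → b ≤ n → 1 ≤ length u → Interval u a b
      → Preceded c a → Preceded c b → longer b ≡ longer a + (b ∸ a) → AllPreceded c a b
    longer-shift⇒AllPreceded u c a b 1≤a a≤b b≤n 1≤|u| ins pre-a pre-b shift j a≤j j≤b =
      subst (2 ≤_) (sym rj≡) (s≤s (proj₁ (r-bounded j′ 1≤j′ j′≤n))) ,
      trans (cong (λ x → charAt w (x ∸ 1)) rj≡) (proj₂ (proj₂ (proj₂ (proj₂ (proj₂ j′-spec)))))
      where
      D = b ∸ a
      d = j ∸ a
      d≤D : d ≤ D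
      d≤D = ∸-monoˡ-≤ a j≤b
      1≤la = proj₁ (longer-spec a c 1≤a (≤-trans a≤b b≤n) pre-a)
      lb≤n = proj₁ (proj₂ (longer-spec b c (≤-trans 1≤a a≤b) b≤n pre-b))
      shorter-mono = shorter-increasing c u (longer a) (longer b) 1≤la lb≤n 1≤|u| (⊑-between-longer u c a b 1≤a a≤b b≤n ins pre-a pre-b)
      j′ = longer a + d
      j′+[D∸d]≡lb : j′ + (D ∸ d) ≡ longer b
      j′+[D∸d]≡lb = trans (+-assoc (longer a) d (D ∸ d)) (trans (cong (longer a +_) (m+[n∸m]≡n d≤D)) (sym shift))
      j+[D∸d]≡b : j + (D ∸ d) ≡ b
      j+[D∸d]≡b = begin
        j + (D ∸ d)          ≡⟨ cong (_+ (D ∸ d)) (m+[n∸m]≡n a≤j) ⟨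
        a + d + (D ∸ d)      ≡⟨ +-assoc a d (D ∸ d) ⟩
        a + (d + (D ∸ d))    ≡⟨ cong (a +_) (m+[n∸m]≡n d≤D) ⟩
        a + D                ≡⟨ m+[n∸m]≡n a≤b ⟩
        b                    ∎
        where open ≡-Reasoning
      la≤j′ : longer a ≤ j′
      la≤j′ = m≤m+n (longer a) d
      j′≤lb : j′ ≤ longer b
      j′≤lb = ≤-trans (m≤m+n j′ (D ∸ d)) (≤-reflexive j′+[D∸d]≡lb)
      1≤j′ = ≤-trans 1≤la la≤j′
      j′≤n = ≤-trans j′≤lb lb≤n
      j≤shorter-j′ : j ≤ shorter j′
      j≤shorter-j′ = subst (_≤ shorter j′) (trans (cong (_+ d) (shorter∘longer a c 1≤a (≤-trans a≤b b≤n) pre-a)) (m+[n∸m]≡n a≤j))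
        (strictlyIncreasing⇒+≤ shorter (longer a) (longer b) shorter-mono d (≤-trans (m≤m+n j′ (D ∸ d)) (≤-reflexive j′+[D∸d]≡lb)))
      shorter-j′≤j : shorter j′ ≤ j
      shorter-j′≤j = +-cancelʳ-≤ (D ∸ d) (shorter j′) j (begin
        shorter j′ + (D ∸ d)       ≤⟨ strictlyIncreasing⇒+≤ shorter j′ (longer b)
                                        (λ x y j′≤x → shorter-mono x y (≤-trans la≤j′ j′≤x)) (D ∸ d) (≤-reflexive j′+[D∸d]≡lb) ⟩
        shorter (j′ + (D ∸ d))     ≡⟨ cong shorter j′+[D∸d]≡lb ⟩
        shorter (longer b)         ≡⟨ shorter∘longer b c (≤-trans 1≤a a≤b) b≤n pre-b ⟩
        b                          ≡⟨ j+[D∸d]≡b ⟨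
        j + (D ∸ d)                ∎)
        where open ≤-Reasoning
      j′-spec = shorter-spec j′ c u 1≤j′ j′≤n 1≤|u| (⊑-between-longer u c a b 1≤a a≤b b≤n ins pre-a pre-b j′ la≤j′ j′≤lb)
      rj≡ : r j ≡ suc (r j′)
      rj≡ = trans (cong r (sym (≤-antisym shorter-j′≤j j≤shorter-j′))) (proj₁ (proj₂ (proj₂ j′-spec)))

    ⊑-propagate-up : ∀ v a b → (∀ t → a ≤ t → t < b → length v ≤ L t) → v ⊑ s a
      → ∀ j → a ≤ j → j ≤ b → v ⊑ s j
    ⊑-propagate-up v a b |v|≤L v⊑sa j a≤j j≤b =
      subst (λ x → v ⊑ s x) (m+[n∸m]≡n a≤j) (go (j ∸ a) (subst (_≤ b) (sym (m+[n∸m]≡n a≤j)) j≤b))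
      where
      go : ∀ k → a + k ≤ b → v ⊑ s (a + k)
      go zero _ = subst (λ x → v ⊑ s x) (sym (+-identityʳ a)) v⊑sa
      go (suc k) a+k<b = subst (λ x → v ⊑ s x) (sym (+-suc a k))
        (⊑-lcpʳ v (s (a + k)) (s (suc (a + k))) (|v|≤L (a + k) (m≤m+n a k) a+k<b′) (go k (<⇒≤ a+k<b′)))
        where
        a+k<b′ : a + k < b
        a+k<b′ = subst (_≤ b) (+-suc a k) a+k<b

    ⊑-propagate-down : ∀ v a b → (∀ t → a ≤ t → t < b → length v ≤ L t) → v ⊑ s b
      → ∀ j → a ≤ j → j ≤ b → v ⊑ s j
    ⊑-propagate-down v a b |v|≤L v⊑sb j a≤j j≤b = go (b ∸ j) j (m+[n∸m]≡n j≤b) a≤j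
      where
      go : ∀ k j → j + k ≡ b → a ≤ j → v ⊑ s j
      go zero j j+0≡b _ = subst (λ x → v ⊑ s x) (trans (sym j+0≡b) (+-identityʳ j)) v⊑sb
      go (suc k) j j+1+k≡b a≤j = ⊑-lcpˡ v (s j) (s (suc j)) (|v|≤L j a≤j j<b)
          (go k (suc j) (trans (sym (+-suc j k)) j+1+k≡b) (≤-trans a≤j (n≤1+n j)))
        where
        j<b : j < b
        j<b = ≤-trans (s≤s (m≤m+n j k)) (≤-reflexive (trans (sym (+-suc j k)) j+1+k≡b))

    record LcpInterval (ℓ a b : ℕ) : Set where
      field
        1≤ℓ : 1 ≤ ℓ
        1≤a : 1 ≤ a
        a<b : a < b
        b≤n : b ≤ n
        left-end : a ≡ 1 ⊎ L (a ∸ 1) < ℓ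
        right-end : b ≡ n ⊎ L b < ℓ
        ℓ≤L : ∀ t → a ≤ t → t < b → ℓ ≤ L t

    LcpInterval⇒Interval : ∀ {a b} i → a ≤ i → i < b → LcpInterval (L i) a b → Interval (take (L i) (s i)) a b
    LcpInterval⇒Interval {a} {b} i a≤i i<b li = record
      { ⊑-inside = inside
      ; ⊑⇒inside = λ j 1≤j j≤n u⊑sj → a≤ j 1≤j u⊑sj , ≤b j j≤n u⊑sj }
      where
      open LcpInterval li
      u = take (L i) (s i)
      |u|≡ : length u ≡ L i
      |u|≡ = length-take (L i) (s i) (lcp≤length (s i) (s (suc i)))
      |u|≤L : ∀ t → a ≤ t → t < b → length u ≤ L t
      |u|≤L t a≤t t<b = subst (_≤ L t) (sym |u|≡) (ℓ≤L t a≤t t<b)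
      u⊑si : u ⊑ s i
      u⊑si = take-⊑ (L i) (s i)
      i≤n = ≤-trans (<⇒≤ i<b) b≤n
      inside : ∀ j → a ≤ j → j ≤ b → u ⊑ s j
      inside j a≤j j≤b with ≤-total j i
      ... | inj₁ j≤i = ⊑-propagate-down u a i (λ t a≤t t<i → |u|≤L t a≤t (<-trans t<i i<b)) u⊑si j a≤j j≤i
      ... | inj₂ i≤j = ⊑-propagate-up u i b (λ t i≤t t<b → |u|≤L t (≤-trans a≤i i≤t) t<b) u⊑si j i≤j j≤b
      L<|u|-contradiction : ∀ t → L t < L i → u ⊑ s t → u ⊑ s (suc t) → ⊥
      L<|u|-contradiction t L<Li u⊑st u⊑st+1 = <⇒≱ L<Li (subst (_≤ L t) |u|≡ (⊑-both⇒≤lcp u (s t) (s (suc t)) u⊑st u⊑st+1))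
      a≤ : ∀ j → 1 ≤ j → u ⊑ s j → a ≤ j
      a≤ j 1≤j u⊑sj with a ≤? j
      ... | yes a≤j = a≤j
      ... | no a≰j with left-end
      ...   | inj₁ refl = ⊥-elim (a≰j 1≤j)
      ...   | inj₂ L<Li = ⊥-elim (L<|u|-contradiction (a ∸ 1) L<Li
          (⊑-s-convex u j (a ∸ 1) i 1≤j (≤-pred (subst (j <_) (sym a-1+1) (≰⇒> a≰j))) (≤-trans (m∸n≤m a 1) a≤i) i≤n u⊑sj u⊑si)
          (subst (λ x → u ⊑ s x) (sym a-1+1) (inside a ≤-refl (<⇒≤ a<b))))
        where
        a-1+1 : suc (a ∸ 1) ≡ a
        a-1+1 = m+[n∸m]≡n 1≤a
      ≤b : ∀ j → j ≤ n → u ⊑ s j → j ≤ b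
      ≤b j j≤n u⊑sj with j ≤? b
      ... | yes j≤b = j≤b
      ... | no j≰b with right-end
      ...   | inj₁ refl = ⊥-elim (j≰b j≤n)
      ...   | inj₂ L<Li = ⊥-elim (L<|u|-contradiction b L<Li (inside b (<⇒≤ (≤-<-trans a≤i i<b)) ≤-refl)
          (⊑-s-convex u i (suc b) j (≤-trans 1≤a a≤i) (≤-trans (<⇒≤ i<b) (n≤1+n b)) (≰⇒> j≰b) j≤n u⊑si u⊑sj))

    Interval⇒OccursAt : ∀ {u a b} → 1 ≤ a → b ≤ n → 1 ≤ length u → Interval u a b
      → ∀ j → a ≤ j → j ≤ b → OccursAt w u (r j)
    Interval⇒OccursAt 1≤a b≤n 1≤|u| ins j a≤j j≤b =
      rank⇒OccursAt (≤-trans 1≤a a≤j) (≤-trans j≤b b≤n) 1≤|u| (Interval.⊑-inside ins j a≤j j≤b)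

    OccursAt⇒Interval : ∀ {u a b k} → Interval u a b → OccursAt w u k → ∃ λ j → a ≤ j × j ≤ b × r j ≡ k
    OccursAt⇒Interval ins o with OccursAt⇒rank o
    ... | j , 1≤j , j≤n , rj≡k , u⊑sj with Interval.⊑⇒inside ins j 1≤j j≤n u⊑sj
    ...   | a≤j , j≤b = j , a≤j , j≤b , rj≡k

    Interval⇒2≤occ : ∀ {u a b} → 1 ≤ a → a < b → b ≤ n → 1 ≤ length u → Interval u a b → 2 ≤ occ w u
    Interval⇒2≤occ {u} {a} {b} 1≤a a<b b≤n 1≤|u| ins = occ-≥ {ks = r a ∷ r b ∷ []} ((ra≢rb ∷ []) ∷ [] ∷ []) u-occurs
      where
      ra≢rb : r a ≢ r b
      ra≢rb ra≡rb = <⇒≢ a<b (r-injective a b 1≤a (≤-trans (<⇒≤ a<b) b≤n) (≤-trans 1≤a (<⇒≤ a<b)) b≤n ra≡rb)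
      u-occurs : ∀ {k} → k ∈ r a ∷ r b ∷ [] → OccursAt w u k
      u-occurs (here refl) = Interval⇒OccursAt 1≤a b≤n 1≤|u| ins a ≤-refl (<⇒≤ a<b)
      u-occurs (there (here refl)) = Interval⇒OccursAt 1≤a b≤n 1≤|u| ins b (<⇒≤ a<b) ≤-refl

    -- s i and s (i + 1) cannot both continue u = take (L i) (s i) with the same letter.
    right-maximal : ∀ i u → 1 ≤ i → suc i ≤ n → 1 ≤ length u → length u ≡ L i → u ⊑ s i → u ⊑ s (suc i)
      → ∀ c → occ w (u ++ c ∷ []) < occ w u
    right-maximal i u 1≤i i<n 1≤|u| |u|≡Li u⊑si u⊑si+1 c with occursAt? w (u ++ c ∷ []) (r i)
    ... | no ¬at-ri = occ-++-[]< w u c (r i) (rank⇒OccursAt 1≤i (≤-trans (n≤1+n i) i<n) 1≤|u| u⊑si) ¬at-ri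
    ... | yes at-ri with occursAt? w (u ++ c ∷ []) (r (suc i))
    ...   | no ¬at-ri+1 = occ-++-[]< w u c (r (suc i)) (rank⇒OccursAt (≤-trans 1≤i (n≤1+n i)) i<n 1≤|u| u⊑si+1) ¬at-ri+1
    ...   | yes at-ri+1 = ⊥-elim (1+n≰n (begin
      suc (length u)           ≡⟨ length-++-[ u ] c ⟨
      length (u ++ c ∷ [])     ≤⟨ ⊑-both⇒≤lcp (u ++ c ∷ []) (s i) (s (suc i))
                                    (proj₂ (proj₂ (OccursAt⇒⊑ at-ri))) (proj₂ (proj₂ (OccursAt⇒⊑ at-ri+1))) ⟩
      L i                      ≡⟨ |u|≡Li ⟨
      length u                 ∎))
      where open ≤-Reasoning

    -- The third clause of the report condition of findmaxr.
    LeftDiverse : ℕ → ℕ → Set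
    LeftDiverse a b = r a ≡ 1 ⊎ r b ≡ 1 ⊎ charAt w (r a ∸ 1) ≢ charAt w (r b ∸ 1) ⊎ longer b ≢ longer a + (b ∸ a)

    LeftDiverse⇒left-maximal : ∀ {u a b} → 1 ≤ a → a ≤ b → b ≤ n → 1 ≤ length u → Interval u a b → LeftDiverse a b
      → ∀ c → occ w (c ∷ u) < occ w u
    LeftDiverse⇒left-maximal {u} {a} {b} 1≤a a≤b b≤n 1≤|u| ins diverse c with any? (λ j → notPrecededBy? w c (r j)) (range a b)
    ... | yes some with find some
    ...   | j , j∈ , unpreceded =
      occ-∷< w u c (r j) (Interval⇒OccursAt 1≤a b≤n 1≤|u| ins j (proj₁ (∈-range⁻ j∈)) (proj₂ (∈-range⁻ j∈))) unpreceded
    LeftDiverse⇒left-maximal {u} {a} {b} 1≤a a≤b b≤n 1≤|u| ins diverse c | no none = ⊥-elim (undiverse diverse)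
      where
      all-preceded : AllPreceded c a b
      all-preceded j a≤j j≤b with All.lookup (All.¬Any⇒All¬ _ none) (∈-range⁺ a≤j j≤b)
      ... | preceded = ≤∧≢⇒< (proj₁ (r-bounded j (≤-trans 1≤a a≤j) (≤-trans j≤b b≤n))) (λ 1≡rj → preceded (inj₁ (sym 1≡rj))) ,
                       decidable-stable (Maybe.≡-dec _≟A_ _ _) (λ ¬c → preceded (inj₂ ¬c))
      undiverse : ¬ LeftDiverse a b
      undiverse (inj₁ ra≡1) = <⇒≢ (proj₁ (all-preceded a ≤-refl a≤b)) (sym ra≡1)
      undiverse (inj₂ (inj₁ rb≡1)) = <⇒≢ (proj₁ (all-preceded b a≤b ≤-refl)) (sym rb≡1)
      undiverse (inj₂ (inj₂ (inj₁ chars≢))) = chars≢ (trans (proj₂ (all-preceded a ≤-refl a≤b)) (sym (proj₂ (all-preceded b a≤b ≤-refl))))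
      undiverse (inj₂ (inj₂ (inj₂ unshifted))) = unshifted (AllPreceded⇒longer-shift u c a b 1≤a a≤b b≤n 1≤|u| ins all-preceded)

    LcpInterval⇒MaximalRepeat : ∀ {a b} i → a ≤ i → i < b → LcpInterval (L i) a b → LeftDiverse a b
      → MaximalRepeat w (take (L i) (s i))
    LcpInterval⇒MaximalRepeat {a} {b} i a≤i i<b li diverse =
      one-letter-maximal⇒MaximalRepeat w u
        (Interval⇒2≤occ 1≤a a<b b≤n 1≤|u| ins)
        (LeftDiverse⇒left-maximal 1≤a (<⇒≤ a<b) b≤n 1≤|u| ins diverse)
        (right-maximal i u (≤-trans 1≤a a≤i) (≤-trans i<b b≤n) 1≤|u| |u|≡
          (Interval.⊑-inside ins i a≤i (<⇒≤ i<b)) (Interval.⊑-inside ins (suc i) (≤-trans a≤i (n≤1+n i)) i<b))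
      where
      open LcpInterval li
      u = take (L i) (s i)
      ins = LcpInterval⇒Interval i a≤i i<b li
      |u|≡ : length u ≡ L i
      |u|≡ = length-take (L i) (s i) (lcp≤length (s i) (s (suc i)))
      1≤|u| = subst (1 ≤_) (sym |u|≡) 1≤ℓ

    RankWithPrefix : List A → ℕ → Set
    RankWithPrefix u j = 1 ≤ j × j ≤ n × u ⊑ s j

    rankWithPrefix? : ∀ u j → Dec (RankWithPrefix u j)
    rankWithPrefix? u j = (1 ≤? j) ×-dec (j ≤? n) ×-dec (u ⊑? s j)

    -- The least and the greatest rank whose suffix starts with u bound the interval of u.
    MaximalRepeat⇒Interval : ∀ u → MaximalRepeat w u
      → ∃ λ a → ∃ λ b → 1 ≤ a × a < b × b ≤ n × 1 ≤ length u × Interval u a b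
    MaximalRepeat⇒Interval u (2≤occ , _) with Unique⇒two-distinct 2≤occ (occurrences-unique w u)
    ... | k₁ , k₂ , k₁∈ , k₂∈ , k₁≢k₂
      with OccursAt⇒rank (∈-occurrences⁻ {w} {u} k₁∈) | OccursAt⇒rank (∈-occurrences⁻ {w} {u} k₂∈)
    ...   | j₁ , 1≤j₁ , j₁≤n , refl , u⊑sj₁ | j₂ , 1≤j₂ , j₂≤n , refl , u⊑sj₂
      with least j₁ (1≤j₁ , j₁≤n , u⊑sj₁) | greatest n j₁ (1≤j₁ , j₁≤n , u⊑sj₁) j₁≤n
      where open BoundedSearch (RankWithPrefix u) (rankWithPrefix? u)
    ...     | a , (1≤a , _ , u⊑sa) , _ , below-a | b , (_ , b≤n , u⊑sb) , _ , _ , above-b =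
      a , b , 1≤a , a<b , b≤n , 1≤|u| , ins
      where
      1≤|u| = proj₁ (proj₂ (OccursAt⇒⊑ (∈-occurrences⁻ {w} {u} k₁∈)))
      a≤ : ∀ j → RankWithPrefix u j → a ≤ j
      a≤ j pj = ≮⇒≥ (λ j<a → below-a j j<a pj)
      ≤b : ∀ j → RankWithPrefix u j → j ≤ b
      ≤b j pj = ≮⇒≥ (λ b<j → above-b j b<j (proj₁ (proj₂ pj)) pj)
      a<b : a < b
      a<b with <-cmp j₁ j₂
      ... | tri< j₁<j₂ _ _ = ≤-<-trans (a≤ j₁ (1≤j₁ , j₁≤n , u⊑sj₁)) (<-≤-trans j₁<j₂ (≤b j₂ (1≤j₂ , j₂≤n , u⊑sj₂)))
      ... | tri≈ _ refl _ = ⊥-elim (k₁≢k₂ refl)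
      ... | tri> _ _ j₂<j₁ = ≤-<-trans (a≤ j₂ (1≤j₂ , j₂≤n , u⊑sj₂)) (<-≤-trans j₂<j₁ (≤b j₁ (1≤j₁ , j₁≤n , u⊑sj₁)))
      ins : Interval u a b
      ins = record
        { ⊑-inside = λ j a≤j j≤b → ⊑-s-convex u a j b 1≤a a≤j j≤b b≤n u⊑sa u⊑sb
        ; ⊑⇒inside = λ j 1≤j j≤n u⊑sj → a≤ j (1≤j , j≤n , u⊑sj) , ≤b j (1≤j , j≤n , u⊑sj) }

    Interval⇒LcpInterval : ∀ {u a b} → 1 ≤ a → a < b → b ≤ n → 1 ≤ length u → Interval u a b → LcpInterval (length u) a b
    Interval⇒LcpInterval {u} {a} {b} 1≤a a<b b≤n 1≤|u| ins = record
      { 1≤ℓ = 1≤|u| ; 1≤a = 1≤a ; a<b = a<b ; b≤n = b≤n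
      ; left-end = left-end ; right-end = right-end ; ℓ≤L = ℓ≤L }
      where
      open Interval ins
      ℓ≤L : ∀ t → a ≤ t → t < b → length u ≤ L t
      ℓ≤L t a≤t t<b = ⊑-both⇒≤lcp u (s t) (s (suc t)) (⊑-inside t a≤t (<⇒≤ t<b)) (⊑-inside (suc t) (≤-trans a≤t (n≤1+n t)) t<b)
      left-end : a ≡ 1 ⊎ L (a ∸ 1) < length u
      left-end with a ≟ 1 | length u ≤? L (a ∸ 1)
      ... | yes a≡1 | _ = inj₁ a≡1
      ... | no _ | no |u|≰L = inj₂ (≰⇒> |u|≰L)
      ... | no a≢1 | yes |u|≤L = ⊥-elim (<⇒≱ (subst (a ∸ 1 <_) a-1+1 ≤-refl)
          (proj₁ (⊑⇒inside (a ∸ 1) 1≤a-1 (≤-trans (m∸n≤m a 1) (≤-trans (<⇒≤ a<b) b≤n))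
            (⊑-lcpˡ u (s (a ∸ 1)) (s (suc (a ∸ 1))) |u|≤L (subst (λ x → u ⊑ s x) (sym a-1+1) (⊑-inside a ≤-refl (<⇒≤ a<b)))))))
        where
        a-1+1 : suc (a ∸ 1) ≡ a
        a-1+1 = m+[n∸m]≡n 1≤a
        1≤a-1 : 1 ≤ a ∸ 1
        1≤a-1 = ≤-pred (subst (2 ≤_) (sym a-1+1) (≤∧≢⇒< 1≤a (λ 1≡a → a≢1 (sym 1≡a))))
      right-end : b ≡ n ⊎ L b < length u
      right-end with b ≟ n | length u ≤? L b
      ... | yes b≡n | _ = inj₁ b≡n
      ... | no _ | no |u|≰L = inj₂ (≰⇒> |u|≰L)
      ... | no b≢n | yes |u|≤L = ⊥-elim (1+n≰n (proj₂ (⊑⇒inside (suc b) (s≤s z≤n) (≤∧≢⇒< b≤n b≢n)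
          (⊑-lcpʳ u (s b) (s (suc b)) |u|≤L (⊑-inside b (<⇒≤ a<b) ≤-refl)))))

    -- Otherwise all of [a, b] shares a letter c after u, and u ++ [c] occurs as often as u.
    MaximalRepeat⇒L-attained : ∀ {u a b} → MaximalRepeat w u → LcpInterval (length u) a b → Interval u a b
      → ∃ λ t → a ≤ t × t < b × L t ≡ length u
    MaximalRepeat⇒L-attained {u} {a} {b} (_ , maximal) li ins
      with any? (λ t → (t <? b) ×-dec (L t ≟ length u)) (range a b)
    ... | yes some with find some
    ...   | t , t∈ , t<b , Lt≡ = t , proj₁ (∈-range⁻ t∈) , t<b , Lt≡
    MaximalRepeat⇒L-attained {u} {a} {b} (_ , maximal) li ins | no none =
      ⊥-elim (<⇒≱ (maximal (u ++ c ∷ []) (IsExtension-++-[ u ] c 1≤ℓ))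
                  (occ-≥ (occurrences-unique w u) uc-occurs))
      where
      open LcpInterval li
      |u|<L : ∀ t → a ≤ t → t < b → length u < L t
      |u|<L t a≤t t<b = ≤∧≢⇒< (ℓ≤L t a≤t t<b) (λ |u|≡L → All.lookup (All.¬Any⇒All¬ _ none) (∈-range⁺ a≤t (<⇒≤ t<b)) (t<b , sym |u|≡L))
      c-extends = ⊑-extend (Interval.⊑-inside ins a ≤-refl (<⇒≤ a<b)) (<-≤-trans (|u|<L a ≤-refl a<b) (lcp≤length (s a) (s (suc a))))
      c = proj₁ c-extends
      uc⊑ : ∀ j → a ≤ j → j ≤ b → u ++ c ∷ [] ⊑ s j
      uc⊑ = ⊑-propagate-up (u ++ c ∷ []) a b (λ t a≤t t<b → subst (_≤ L t) (sym (length-++-[ u ] c)) (|u|<L t a≤t t<b)) (proj₂ c-extends)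
      uc-occurs : ∀ {k} → k ∈ occurrences w u → OccursAt w (u ++ c ∷ []) k
      uc-occurs k∈ with OccursAt⇒Interval ins (∈-occurrences⁻ k∈)
      ... | j , a≤j , j≤b , refl =
        rank⇒OccursAt (≤-trans 1≤a a≤j) (≤-trans j≤b b≤n) (subst (1 ≤_) (sym (length-++-[ u ] c)) (s≤s z≤n)) (uc⊑ j a≤j j≤b)

    -- Otherwise every occurrence of u is preceded by the letter before s a, and c ∷ u occurs as often as u.
    MaximalRepeat⇒LeftDiverse : ∀ {u a b} → MaximalRepeat w u → 1 ≤ a → a < b → b ≤ n → 1 ≤ length u → Interval u a b
      → LeftDiverse a b
    MaximalRepeat⇒LeftDiverse {u} {a} {b} (_ , maximal) 1≤a a<b b≤n 1≤|u| ins with r a ≟ 1 | r b ≟ 1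
    ... | yes ra≡1 | _ = inj₁ ra≡1
    ... | no _ | yes rb≡1 = inj₂ (inj₁ rb≡1)
    ... | no ra≢1 | no rb≢1 with charAt-defined w (r a ∸ 1) 1≤ra-1 (≤-trans (m∸n≤m (r a) 1) (proj₂ (r-bounded a 1≤a a≤n)))
      where
      a≤n = ≤-trans (<⇒≤ a<b) b≤n
      1≤ra-1 : 1 ≤ r a ∸ 1
      1≤ra-1 = ∸-monoˡ-≤ 1 (≤∧≢⇒< (proj₁ (r-bounded a 1≤a a≤n)) (λ 1≡ra → ra≢1 (sym 1≡ra)))
    ... | c , c-before-a with Maybe.≡-dec _≟A_ (charAt w (r b ∸ 1)) (just c)
    ...   | no c-not-before-b = inj₂ (inj₂ (inj₁ (λ chars≡ → c-not-before-b (trans (sym chars≡) c-before-a))))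
    ...   | yes c-before-b with longer b ≟ longer a + (b ∸ a)
    ...     | no unshifted = inj₂ (inj₂ (inj₂ unshifted))
    ...     | yes shift with occ-∷<⇒NotPrecededBy w u c (maximal (c ∷ u) (IsExtension-∷ u c 1≤|u|))
    ...       | k , u-at-k , unpreceded with OccursAt⇒Interval ins u-at-k
    ...         | j , a≤j , j≤b , refl = ⊥-elim (preceded-contradiction unpreceded)
      where
      2≤r : ∀ j → 1 ≤ j → j ≤ n → r j ≢ 1 → 2 ≤ r j
      2≤r j 1≤j j≤n rj≢1 = ≤∧≢⇒< (proj₁ (r-bounded j 1≤j j≤n)) (λ 1≡rj → rj≢1 (sym 1≡rj))
      pre-j : Preceded c j
      pre-j = longer-shift⇒AllPreceded u c a b 1≤a (<⇒≤ a<b) b≤n 1≤|u| ins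
                (2≤r a 1≤a (≤-trans (<⇒≤ a<b) b≤n) ra≢1 , c-before-a) (2≤r b (≤-trans 1≤a (<⇒≤ a<b)) b≤n rb≢1 , c-before-b)
                shift j a≤j j≤b
      preceded-contradiction : ¬ NotPrecededBy w c (r j)
      preceded-contradiction (inj₁ rj≡1) = <⇒≢ (proj₁ pre-j) (sym rj≡1)
      preceded-contradiction (inj₂ ¬c) = ¬c (proj₂ pre-j)

    module F = FindMaxR w r p

    ReportCondition : ℕ → ℕ → ℕ → Set
    ReportCondition i a b = (a ≡ 1 ⊎ L (a ∸ 1) ≢ L i) × (b ≡ n ⊎ L b ≢ L i) × LeftDiverse a b

    reportCond⇔ : ∀ i a b → T (F.reportCond i a b) ⇔ ReportCondition i a b
    reportCond⇔ i a b =
      ∧⇔ (∨⇔ T-≡ᵇ T-not-≡ᵇ) (∧⇔ (∨⇔ T-≡ᵇ T-not-≡ᵇ) (∨⇔ T-≡ᵇ (∨⇔ T-≡ᵇ (∨⇔ (T-not ⟨⇔⟩ ¬-⇔ (T-eqChar _ _)) T-not-≡ᵇ))))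
      where
      _⟨⇔⟩_ = Equivalence-trans
      ∧⇔ : ∀ {x y} {P Q : Set} → T x ⇔ P → T y ⇔ Q → T (x ∧ y) ⇔ (P × Q)
      ∧⇔ x⇔P y⇔Q = T-∧ ⟨⇔⟩ (x⇔P ×-⇔ y⇔Q)
      ∨⇔ : ∀ {x y} {P Q : Set} → T x ⇔ P → T y ⇔ Q → T (x ∨ y) ⇔ (P ⊎ Q)
      ∨⇔ x⇔P y⇔Q = T-∨ ⟨⇔⟩ (x⇔P ⊎-⇔ y⇔Q)
      T-≡ᵇ : ∀ {m k} → T (m ≡ᵇ k) ⇔ m ≡ k
      T-≡ᵇ = mk⇔ (≡ᵇ⇒≡ _ _) (≡⇒≡ᵇ _ _)
      T-not : ∀ {b} → T (not b) ⇔ (¬ T b)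
      T-not {true} = mk⇔ (λ ()) (λ ¬t → ¬t _)
      T-not {false} = mk⇔ (λ _ ()) (λ _ → _)
      ¬-⇔ : ∀ {P Q : Set} → P ⇔ Q → (¬ P) ⇔ (¬ Q)
      ¬-⇔ P⇔Q = mk⇔ (λ ¬p q → ¬p (Equivalence.from P⇔Q q)) (λ ¬q p → ¬q (Equivalence.to P⇔Q p))
      T-not-≡ᵇ : ∀ {m k} → T (not (m ≡ᵇ k)) ⇔ (m ≢ k)
      T-not-≡ᵇ = T-not ⟨⇔⟩ ¬-⇔ T-≡ᵇ

    reported-string≡take : ∀ i → 1 ≤ i → i ≤ n → sub w (r i) (r i + L i ∸ 1) ≡ take (L i) (s i)
    reported-string≡take i 1≤i i≤n = go (r i) (proj₁ (r-bounded i 1≤i i≤n))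
      where
      go : ∀ k → 1 ≤ k → sub w k (k + L i ∸ 1) ≡ take (L i) (suffix w k)
      go (suc k) _ = sub≡take-suffix w k (L i)

    length-reported-string : ∀ i → 1 ≤ i → i ≤ n → length (sub w (r i) (r i + L i ∸ 1)) ≡ L i
    length-reported-string i 1≤i i≤n =
      trans (cong length (reported-string≡take i 1≤i i≤n)) (length-take (L i) (s i) (lcp≤length (s i) (s (suc i))))

    report : ℕ → List ℕ → Report
    report i S = sub w (r i) (r i + L i ∸ 1) , map r (range (maxBelow i S + 1) (minAbove n i S))

    reports? : ℕ → List ℕ → Bool
    reports? i S = F.reportCond i (maxBelow i S + 1) (minAbove n i S)

    ∈-run⁻ : ∀ S os {x} → x ∈ F.run S os →
      ∃ λ pre → ∃ λ i → ∃ λ post → os ≡ pre ++ i ∷ post × T (reports? i (pre ʳ++ S)) × x ≡ report i (pre ʳ++ S)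
    ∈-run⁻ S (i ∷ is) {x} x∈ = go (reports? i S) refl x∈
      where
      later : x ∈ F.run (i ∷ S) is →
        ∃ λ pre → ∃ λ j → ∃ λ post → i ∷ is ≡ pre ++ j ∷ post × T (reports? j (pre ʳ++ S)) × x ≡ report j (pre ʳ++ S)
      later x∈′ with ∈-run⁻ (i ∷ S) is x∈′
      ... | pre , j , post , refl , reports , refl = i ∷ pre , j , post , refl , reports , refl
      go : ∀ b → reports? i S ≡ b → x ∈ (if b then report i S ∷ [] else []) ++ F.run (i ∷ S) is →
        ∃ λ pre → ∃ λ j → ∃ λ post → i ∷ is ≡ pre ++ j ∷ post × T (reports? j (pre ʳ++ S)) × x ≡ report j (pre ʳ++ S)
      go true eq (here refl) = [] , i , is , refl , subst T (sym eq) _ , refl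
      go true _ (there x∈′) = later x∈′
      go false _ x∈′ = later x∈′

    ∈-run⁺ : ∀ pre S i post → T (reports? i (pre ʳ++ S)) → report i (pre ʳ++ S) ∈ F.run S (pre ++ i ∷ post)
    ∈-run⁺ [] S i post reports = here-if (reports? i S) reports
      where
      here-if : ∀ b → T b → report i S ∈ (if b then report i S ∷ [] else []) ++ F.run (i ∷ S) post
      here-if true _ = here refl
    ∈-run⁺ (j ∷ pre) S i post reports =
      ∈-++⁺ʳ (if reports? j S then report j S ∷ [] else []) (∈-run⁺ pre (j ∷ S) i post reports)

    ReportLength≤ : Report → Report → Set
    ReportLength≤ x y = length (proj₁ x) ≤ length (proj₁ y)

    run-lengths-≥ : ∀ S os k → (∀ {t} → t ∈ os → k ≤ L t × 1 ≤ t × t ≤ n)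
      → All (λ x → k ≤ length (proj₁ x)) (F.run S os)
    run-lengths-≥ S [] k _ = []
    run-lengths-≥ S (i ∷ is) k bounds = go (reports? i S)
      where
      later = run-lengths-≥ (i ∷ S) is k (λ t∈ → bounds (there t∈))
      go : ∀ b → All (λ x → k ≤ length (proj₁ x)) ((if b then report i S ∷ [] else []) ++ F.run (i ∷ S) is)
      go true with bounds (here refl)
      ... | k≤Li , 1≤i , i≤n = subst (k ≤_) (sym (length-reported-string i 1≤i i≤n)) k≤Li ∷ later
      go false = later

    run-sorted : ∀ S os → AllPairs (λ s t → L s ≤ L t) os → (∀ {t} → t ∈ os → 1 ≤ t × t ≤ n)
      → AllPairs ReportLength≤ (F.run S os)
    run-sorted S [] _ _ = []
    run-sorted S (i ∷ is) (Li≤ ∷ sorted) bounds = go (reports? i S)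
      where
      later = run-sorted (i ∷ S) is sorted (λ t∈ → bounds (there t∈))
      go : ∀ b → AllPairs ReportLength≤ ((if b then report i S ∷ [] else []) ++ F.run (i ∷ S) is)
      go true with bounds (here refl)
      ... | 1≤i , i≤n = subst (λ ℓ → All (λ x → ℓ ≤ length (proj₁ x)) (F.run (i ∷ S) is)) (sym (length-reported-string i 1≤i i≤n))
          (run-lengths-≥ (i ∷ S) is (L i) (λ t∈ → All.lookup Li≤ t∈ , bounds (there t∈))) ∷ later
      go false = later

    module Run (order : List ℕ) (perm : order ↭ F.toProcess 1) (sorted : Linked (λ s t → L s ≤ L t) order) where

      S₀ : List ℕ
      S₀ = F.initialS 1

      ∈-order⁻ : ∀ {t} → t ∈ order → 1 ≤ t × t < n × 1 ≤ L t
      ∈-order⁻ t∈ with ∈-filter⁻ (λ t → 1 ≤? L t) {xs = range 1 (n ∸ 1)} (∈-resp-↭ perm t∈)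
      ... | t∈range , 1≤Lt = proj₁ (∈-range⁻ t∈range) , 0<m≤n∸1⇒m<n (proj₁ (∈-range⁻ t∈range)) (proj₂ (∈-range⁻ t∈range)) , 1≤Lt

      ∈-order⁺ : ∀ {t} → 1 ≤ t → t < n → 1 ≤ L t → t ∈ order
      ∈-order⁺ 1≤t t<n 1≤Lt = ∈-resp-↭ (↭-sym perm) (∈-filter⁺ (λ t → 1 ≤? L t) (∈-range⁺ 1≤t (m<n⇒m≤n∸1 t<n)) 1≤Lt)

      ∈-state⁻ : ∀ pre {t} → t ∈ pre ʳ++ S₀ → t ∈ pre ⊎ L t < 1 ⊎ t ≡ 0 ⊎ t ≡ n
      ∈-state⁻ pre t∈ with Any.reverseAcc⁻ S₀ pre t∈
      ... | inj₂ t∈pre = inj₁ t∈pre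
      ... | inj₁ t∈S₀ with ∈-++⁻ (filter (λ t → L t <? 1) (range 1 (n ∸ 1))) t∈S₀
      ...   | inj₁ t∈small = inj₂ (inj₁ (proj₂ (∈-filter⁻ (λ t → L t <? 1) {xs = range 1 (n ∸ 1)} t∈small)))
      ...   | inj₂ (here refl) = inj₂ (inj₂ (inj₁ refl))
      ...   | inj₂ (there (here refl)) = inj₂ (inj₂ (inj₂ refl))

      ∈-state⁺ˡ : ∀ pre {t} → t ∈ pre → t ∈ pre ʳ++ S₀
      ∈-state⁺ˡ pre t∈pre = Any.reverseAcc⁺ S₀ pre (inj₂ t∈pre)

      ∈-state⁺ʳ : ∀ pre {t} → t ∈ S₀ → t ∈ pre ʳ++ S₀
      ∈-state⁺ʳ pre t∈S₀ = Any.reverseAcc⁺ S₀ pre (inj₁ t∈S₀)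

      small∈S₀ : ∀ {t} → 1 ≤ t → t < n → L t < 1 → t ∈ S₀
      small∈S₀ 1≤t t<n Lt<1 = ∈-++⁺ˡ (∈-filter⁺ (λ t → L t <? 1) (∈-range⁺ 1≤t (m<n⇒m≤n∸1 t<n)) Lt<1)

      0∈S₀ : 0 ∈ S₀
      0∈S₀ = ∈-++⁺ʳ (filter (λ t → L t <? 1) (range 1 (n ∸ 1))) (here refl)

      n∈S₀ : n ∈ S₀
      n∈S₀ = ∈-++⁺ʳ (filter (λ t → L t <? 1) (range 1 (n ∸ 1))) (there (here refl))

      module Step {pre i post} (split : order ≡ pre ++ i ∷ post) where

        S : List ℕ
        S = pre ʳ++ S₀

        i-bounds : 1 ≤ i × i < n × 1 ≤ L i
        i-bounds = ∈-order⁻ (subst (i ∈_) (sym split) (∈-++⁺ʳ pre (here refl)))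

        split-sorted : AllPairs (λ s t → L s ≤ L t) (pre ++ i ∷ post)
        split-sorted = subst (AllPairs _) split (Linked⇒AllPairs ≤-trans sorted)

        earlier-L≤ : ∀ {t} → t ∈ pre → L t ≤ L i
        earlier-L≤ = AllPairs-before pre i post split-sorted

        ∉S⇒L≥ : ∀ t → 1 ≤ t → t < n → t ≢ i → t ∉ S → L i ≤ L t
        ∉S⇒L≥ t 1≤t t<n t≢i t∉S with 1 ≤? L t
        ... | no 1≰Lt = ⊥-elim (t∉S (∈-state⁺ʳ pre (small∈S₀ 1≤t t<n (≰⇒> 1≰Lt))))
        ... | yes 1≤Lt with ∈-++⁻ pre (subst (t ∈_) split (∈-order⁺ 1≤t t<n 1≤Lt))
        ...   | inj₁ t∈pre = ⊥-elim (t∉S (∈-state⁺ˡ pre t∈pre))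
        ...   | inj₂ (here t≡i) = ⊥-elim (t≢i t≡i)
        ...   | inj₂ (there t∈post) = AllPairs-after pre i post split-sorted t∈post

        L<⇒∈S : ∀ t → 1 ≤ t → t < n → t ≢ i → L t < L i → t ∈ S
        L<⇒∈S t 1≤t t<n t≢i Lt<Li with t ∈? S
        ... | yes t∈S = t∈S
        ... | no t∉S = ⊥-elim (<⇒≱ Lt<Li (∉S⇒L≥ t 1≤t t<n t≢i t∉S))

        reports⇒LcpInterval : T (reports? i S) → let a = maxBelow i S + 1 ; b = minAbove n i S in
          a ≤ i × i < b × LcpInterval (L i) a b × LeftDiverse a b
        reports⇒LcpInterval reports = a≤i , i<b , lcp-interval , proj₂ (proj₂ condition)
          where
          m = maxBelow i S
          a = m + 1
          b = minAbove n i S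
          condition = Equivalence.to (reportCond⇔ i a b) reports
          1≤i = proj₁ i-bounds
          i<n = proj₁ (proj₂ i-bounds)
          1≤Li = proj₂ (proj₂ i-bounds)
          a≡1+m : a ≡ suc m
          a≡1+m = +-comm m 1
          a-1≡m : a ∸ 1 ≡ m
          a-1≡m = m+n∸n≡m m 1
          m<i : m < i
          m<i with maxBelow-spec i S
          ... | inj₁ m≡0 = subst (_< i) (sym m≡0) 1≤i
          ... | inj₂ (_ , m<i) = m<i
          a≤i : a ≤ i
          a≤i = subst (_≤ i) (sym a≡1+m) m<i
          i<b : i < b
          i<b with minAbove-spec n i S
          ... | inj₁ b≡n = subst (i <_) (sym b≡n) i<n
          ... | inj₂ (_ , i<b) = i<b
          b≤n = minAbove≤default n i S
          ∉S : ∀ t → a ≤ t → t < b → t ≢ i → t ∉ S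
          ∉S t a≤t t<b t≢i t∈S with <-cmp t i
          ... | tri< t<i _ _ = <⇒≱ (subst (_≤ t) a≡1+m a≤t) (maxBelow-greatest i S t∈S t<i)
          ... | tri≈ _ t≡i _ = t≢i t≡i
          ... | tri> _ _ i<t = <⇒≱ t<b (minAbove-least n i S t∈S i<t)
          ℓ≤L : ∀ t → a ≤ t → t < b → L i ≤ L t
          ℓ≤L t a≤t t<b with t ≟ i
          ... | yes refl = ≤-refl
          ... | no t≢i = ∉S⇒L≥ t (≤-trans (subst (1 ≤_) (sym a≡1+m) (s≤s z≤n)) a≤t) (<-≤-trans t<b b≤n) t≢i (∉S t a≤t t<b t≢i)
          below-level : ∀ t → L t ≢ L i → t ∈ pre ⊎ L t < 1 ⊎ t ≡ 0 ⊎ t ≡ n → t ≡ 0 ⊎ t ≡ n ⊎ L t < L i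
          below-level t Lt≢Li (inj₁ t∈pre) = inj₂ (inj₂ (≤∧≢⇒< (earlier-L≤ t∈pre) Lt≢Li))
          below-level t _ (inj₂ (inj₁ Lt<1)) = inj₂ (inj₂ (<-≤-trans Lt<1 1≤Li))
          below-level t _ (inj₂ (inj₂ t≡0⊎n)) = Sum.map₂ inj₁ t≡0⊎n
          left-end : a ≡ 1 ⊎ L (a ∸ 1) < L i
          left-end with proj₁ condition | maxBelow-spec i S
          ... | inj₁ a≡1 | _ = inj₁ a≡1
          ... | inj₂ _ | inj₁ m≡0 = inj₁ (cong (_+ 1) m≡0)
          ... | inj₂ L≢ | inj₂ (m∈S , _) with below-level m (subst (λ x → L x ≢ L i) a-1≡m L≢) (∈-state⁻ pre m∈S)
          ...   | inj₁ m≡0 = inj₁ (cong (_+ 1) m≡0)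
          ...   | inj₂ (inj₁ m≡n) = ⊥-elim (<⇒≱ (<-trans m<i i<n) (≤-reflexive (sym m≡n)))
          ...   | inj₂ (inj₂ Lm<Li) = inj₂ (subst (λ x → L x < L i) (sym a-1≡m) Lm<Li)
          right-end : b ≡ n ⊎ L b < L i
          right-end with proj₁ (proj₂ condition) | minAbove-spec n i S
          ... | inj₁ b≡n | _ = inj₁ b≡n
          ... | inj₂ _ | inj₁ b≡n = inj₁ b≡n
          ... | inj₂ L≢ | inj₂ (b∈S , _) with below-level b L≢ (∈-state⁻ pre b∈S)
          ...   | inj₁ b≡0 = ⊥-elim (<⇒≱ i<b (≤-trans (≤-reflexive b≡0) z≤n))
          ...   | inj₂ (inj₁ b≡n) = inj₁ b≡n
          ...   | inj₂ (inj₂ Lb<Li) = inj₂ Lb<Li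
          lcp-interval : LcpInterval (L i) a b
          lcp-interval = record
            { 1≤ℓ = 1≤Li ; 1≤a = subst (1 ≤_) (sym a≡1+m) (s≤s z≤n) ; a<b = ≤-<-trans a≤i i<b ; b≤n = b≤n
            ; left-end = left-end ; right-end = right-end ; ℓ≤L = ℓ≤L }

        first-in-LcpInterval⇒reports : ∀ {ℓ a b} → LcpInterval ℓ a b → LeftDiverse a b → a ≤ i → i < b → L i ≡ ℓ
          → (∀ {t} → t ∈ pre → ¬ (a ≤ t × t < b × L t ≡ ℓ))
          → maxBelow i S + 1 ≡ a × minAbove n i S ≡ b × T (reports? i S)
        first-in-LcpInterval⇒reports {ℓ} {a} {b} li diverse a≤i i<b Li≡ℓ first = a≡ , b≡ , reports
          where
          open LcpInterval li
          i<n = <-≤-trans i<b b≤n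
          ∉S : ∀ t → a ≤ t → t < b → t ∉ S
          ∉S t a≤t t<b t∈S with ∈-state⁻ pre t∈S
          ... | inj₁ t∈pre = first t∈pre (a≤t , t<b , ≤-antisym (subst (L t ≤_) Li≡ℓ (earlier-L≤ t∈pre)) (ℓ≤L t a≤t t<b))
          ... | inj₂ (inj₁ Lt<1) = <⇒≱ Lt<1 (≤-trans 1≤ℓ (ℓ≤L t a≤t t<b))
          ... | inj₂ (inj₂ (inj₁ refl)) = <⇒≱ 1≤a a≤t
          ... | inj₂ (inj₂ (inj₂ refl)) = <⇒≱ (<-≤-trans t<b b≤n) ≤-refl
          a-1+1 : suc (a ∸ 1) ≡ a
          a-1+1 = m+[n∸m]≡n 1≤a
          a-1<i : a ∸ 1 < i
          a-1<i = subst (_≤ i) (sym a-1+1) a≤i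
          a-1∈S : a ∸ 1 ∈ S
          a-1∈S with a ∸ 1 ≟ 0 | left-end
          ... | yes a-1≡0 | _ = subst (_∈ S) (sym a-1≡0) (∈-state⁺ʳ pre 0∈S₀)
          ... | no _ | inj₁ refl = ∈-state⁺ʳ pre 0∈S₀
          ... | no a-1≢0 | inj₂ L<ℓ =
            L<⇒∈S (a ∸ 1) (n≢0⇒n>0 a-1≢0) (<-trans a-1<i i<n) (<⇒≢ a-1<i) (subst (L (a ∸ 1) <_) (sym Li≡ℓ) L<ℓ)
          maxBelow≤a-1 : maxBelow i S ≤ a ∸ 1
          maxBelow≤a-1 with maxBelow-spec i S
          ... | inj₁ m≡0 = subst (_≤ a ∸ 1) (sym m≡0) z≤n
          ... | inj₂ (m∈S , m<i) with a ≤? maxBelow i S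
          ...   | yes a≤m = ⊥-elim (∉S _ a≤m (<-trans m<i i<b) m∈S)
          ...   | no a≰m = ≤-pred (subst (suc (maxBelow i S) ≤_) (sym a-1+1) (≰⇒> a≰m))
          a≡ : maxBelow i S + 1 ≡ a
          a≡ = trans (+-comm (maxBelow i S) 1) (trans (cong suc (≤-antisym maxBelow≤a-1 (maxBelow-greatest i S a-1∈S a-1<i))) a-1+1)
          b∈S : b ∈ S
          b∈S with b ≟ n | right-end
          ... | yes refl | _ = ∈-state⁺ʳ pre n∈S₀
          ... | no _ | inj₁ refl = ∈-state⁺ʳ pre n∈S₀
          ... | no b≢n | inj₂ L<ℓ =
            L<⇒∈S b (≤-trans 1≤a (<⇒≤ a<b)) (≤∧≢⇒< b≤n b≢n) (λ b≡i → <⇒≢ i<b (sym b≡i)) (subst (L b <_) (sym Li≡ℓ) L<ℓ)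
          b≤minAbove : b ≤ minAbove n i S
          b≤minAbove with minAbove-spec n i S
          ... | inj₁ m≡n = subst (b ≤_) (sym m≡n) b≤n
          ... | inj₂ (m∈S , i<m) with b ≤? minAbove n i S
          ...   | yes b≤m = b≤m
          ...   | no b≰m = ⊥-elim (∉S _ (≤-trans a≤i (<⇒≤ i<m)) (≰⇒> b≰m) m∈S)
          b≡ : minAbove n i S ≡ b
          b≡ = ≤-antisym (minAbove-least n i S b∈S i<b) b≤minAbove
          level-end : ∀ {x} → L x < ℓ → L x ≢ L i
          level-end Lx<ℓ Lx≡Li = <⇒≢ Lx<ℓ (trans Lx≡Li Li≡ℓ)
          reports : T (reports? i S)
          reports = subst₂ (λ x y → T (F.reportCond i x y)) (sym a≡) (sym b≡)
            (Equivalence.from (reportCond⇔ i a b) (Sum.map₂ level-end left-end , Sum.map₂ level-end right-end , diverse))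

      reported⇒MaximalRepeat : ∀ {u ps} → (u , ps) ∈ F.findmaxr 1 order → MaximalRepeat w u × (∀ k → k ∈ ps ⇔ OccursAt w u k)
      reported⇒MaximalRepeat u∈ with ∈-run⁻ S₀ order u∈
      ... | pre , i , post , split , reports , refl with Step.reports⇒LcpInterval split reports
      ...   | a≤i , i<b , li , diverse =
        subst (MaximalRepeat w) (sym u≡) (LcpInterval⇒MaximalRepeat i a≤i i<b li diverse) , λ k → mk⇔ (to k) (from k)
        where
        open LcpInterval li
        u≡ = reported-string≡take i (proj₁ (Step.i-bounds split)) (<⇒≤ (proj₁ (proj₂ (Step.i-bounds split))))
        ins = LcpInterval⇒Interval i a≤i i<b li
        1≤|u| = subst (1 ≤_) (sym (length-take (L i) (s i) (lcp≤length (s i) (s (suc i))))) 1≤ℓ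
        ps = proj₂ (report i (pre ʳ++ S₀))
        to : ∀ k → k ∈ ps → OccursAt w (sub w (r i) (r i + L i ∸ 1)) k
        to k k∈ with ∈-map⁻ r k∈
        ... | j , j∈ , refl = subst (λ v → OccursAt w v (r j)) (sym u≡)
                (Interval⇒OccursAt 1≤a b≤n 1≤|u| ins j (proj₁ (∈-range⁻ j∈)) (proj₂ (∈-range⁻ j∈)))
        from : ∀ k → OccursAt w (sub w (r i) (r i + L i ∸ 1)) k → k ∈ ps
        from k o with OccursAt⇒Interval ins (subst (λ v → OccursAt w v k) u≡ o)
        ... | j , a≤j , j≤b , refl = ∈-map⁺ r (∈-range⁺ a≤j j≤b)

      MaximalRepeat⇒reported : ∀ u → MaximalRepeat w u → ∃ λ ps → (u , ps) ∈ F.findmaxr 1 order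
      MaximalRepeat⇒reported u mr with MaximalRepeat⇒Interval u mr
      ... | a , b , 1≤a , a<b , b≤n , 1≤|u| , ins with Interval⇒LcpInterval 1≤a a<b b≤n 1≤|u| ins
      ... | li with MaximalRepeat⇒L-attained mr li ins
      ... | t₀ , a≤t₀ , t₀<b , Lt₀≡
        with first-satisfying (λ t → (a ≤? t) ×-dec (t <? b) ×-dec (L t ≟ length u)) order
               (∈-order⁺ (≤-trans 1≤a a≤t₀) (<-≤-trans t₀<b b≤n) (subst (1 ≤_) (sym Lt₀≡) 1≤|u|)) (a≤t₀ , t₀<b , Lt₀≡)
      ... | pre , i , post , split , (a≤i , i<b , Li≡) , first
        with Step.first-in-LcpInterval⇒reports split li (MaximalRepeat⇒LeftDiverse mr 1≤a a<b b≤n 1≤|u| ins) a≤i i<b Li≡ first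
      ... | _ , _ , reports =
        proj₂ (report i (pre ʳ++ S₀)) ,
        subst₂ (λ v os → (v , proj₂ (report i (pre ʳ++ S₀))) ∈ F.run S₀ os) u≡ (sym split) (∈-run⁺ pre S₀ i post reports)
        where
        u≡ : sub w (r i) (r i + L i ∸ 1) ≡ u
        u≡ = trans (reported-string≡take i (≤-trans 1≤a a≤i) (≤-trans (<⇒≤ i<b) b≤n))
               (⊑-length-unique (take-⊑ (L i) (s i)) (Interval.⊑-inside ins i a≤i (<⇒≤ i<b))
                 (trans (length-take (L i) (s i) (lcp≤length (s i) (s (suc i)))) Li≡))

      findmaxr-sorted : Linked ReportLength≤ (F.findmaxr 1 order)
      findmaxr-sorted = AllPairs⇒Linked (run-sorted S₀ order (Linked⇒AllPairs ≤-trans sorted)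
        (λ t∈ → proj₁ (∈-order⁻ t∈) , <⇒≤ (proj₁ (proj₂ (∈-order⁻ t∈)))))

theorem2 : {A : Set} (_≺_ : Rel A _) (sto : IsStrictTotalOrder _≡_ _≺_)
    → let open Strings (IsStrictTotalOrder._≟_ sto) in
      (w : List A) (r p : ℕ → ℕ)
    → IsSuffixArray _≺_ w r
    → IsInverse w r p
    → let open FindMaxR w r p in
      (order : List ℕ)
    → order ↭ toProcess 1
    → Linked (λ s t → L s ≤ L t) order
    → let R = findmaxr 1 order in
      (∀ u ps → (u , ps) ∈ R → MaximalRepeat w u)
      × (∀ u ps → (u , ps) ∈ R → ∀ k → (k ∈ ps ⇔ OccursAt w u k))
      × (∀ u → MaximalRepeat w u → ∃ (λ ps → (u , ps) ∈ R))
      × Linked (λ a b → length (proj₁ a) ≤ length (proj₁ b)) R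
theorem2 _≺_ sto w r p sa inv order perm sorted =
  (λ _ _ u∈ → proj₁ (reported⇒MaximalRepeat u∈)) ,
  (λ _ _ u∈ → proj₂ (reported⇒MaximalRepeat u∈)) ,
  MaximalRepeat⇒reported ,
  findmaxr-sorted
  where open Text _≺_ sto using (module SuffixArray)
        open SuffixArray.Run w r p sa inv order perm sorted
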